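{- Let $n\ge1$ and $p$ a prime. Then the quotient $\Sigma(n,p)/\mathcal{R}(n,p)$ of the $p$-modular descent algebra by its radical is commutative.
   Context: A composition of $n$ is a finite sequence $q=[a_1,\dots,a_s]$ of positive integers summing to $n$. For compositions $q=[a_1,\dots,a_s]$, $r=[b_1,\dots,b_t]$ of $n$, let $S(q,r)$ be the set of $s\times t$ matrices $Z=(z_{ij})$ with non-negative integer entries whose $i$-th row sum is $a_i$ and $j$-th column sum is $b_j$. Let $\mathcal{Z}_n$ be the free $\mathbb{Z}$-module with basis $\{B_q\}$ indexed by the compositions of $n$, made into a ring by $B_qB_r=\sum_{Z\in S(q,r)} B_{c(Z)}$, where $c(Z)$ is the composition obtained by reading the entries of $Z$ row by row and omitting zeros. The $p$-modular descent algebra is $\Sigma(n,p)=\mathcal{Z}_n/p\mathcal{Z}_n$ over $\mathbb{F}_p$, and $\mathcal{R}(n,p)$ is its Jacobson radical. -}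

module Defs where

open import Data.Nat using (ℕ; zero; suc; _∸_; _≤?_)
open import Data.Integer as ℤ using (ℤ; +_)
open import Data.Integer.Divisibility using () renaming (_∣_ to _∣ℤ_)
open import Data.List using (List; []; _∷_; map; concatMap; concat; length; upTo; zipWith; foldr)
open import Data.List.Membership.Propositional using (_∈_)
open import Data.List.Properties using (≡-dec)
open import Data.Bool using (Bool; true; false; if_then_else_)
open import Data.Product using (Σ; ∃)
open import Relation.Nullary using (does)
import Data.Nat as ℕ

range : ℕ → ℕ → List ℕ
range lo hi = map (λ i → lo ℕ.+ i) (upTo (suc hi ∸ lo))

-- compositions of m (using n as fuel, with m ≤ fuel)
compsF : ℕ → ℕ → List (List ℕ)
compsF _ zero = [] ∷ []
compsF zero (suc _) = []
compsF (suc f) (suc m) =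
  concatMap (λ k → map (k ∷_) (compsF f (suc m ∸ k))) (range 1 (suc m))

comps : ℕ → List (List ℕ)
comps n = compsF n n

rowsFor : List ℕ → ℕ → List (List ℕ)
rowsFor [] zero = [] ∷ []
rowsFor [] (suc _) = []
rowsFor (b ∷ bs) a =
  concatMap (λ z → if does (z ≤? a) then map (z ∷_) (rowsFor bs (a ∸ z)) else [])
            (range 0 b)

allZero : List ℕ → Bool
allZero [] = true
allZero (zero ∷ xs) = allZero xs
allZero (suc _ ∷ _) = false

-- S(q,r): matrices (as lists of rows) with row sums q and column sums r
S : List ℕ → List ℕ → List (List (List ℕ))
S [] r = if allZero r then [] ∷ [] else []
S (a ∷ as) r = concatMap (λ row → map (row ∷_) (S as (zipWith _∸_ r row))) (rowsFor r a)

dropZeros : List ℕ → List ℕ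
dropZeros [] = []
dropZeros (zero ∷ xs) = dropZeros xs
dropZeros (suc k ∷ xs) = suc k ∷ dropZeros xs

c : List (List ℕ) → List ℕ
c Z = dropZeros (concat Z)

-- number of Z ∈ S(q,r) with c(Z) = w, i.e. the coefficient of B_w in B_q B_r
count : List ℕ → List ℕ → List ℕ → ℕ
count q r w = length (Data.List.filter (λ Z → ≡-dec ℕ._≟_ (c Z) w) (S q r))

sumℤ : List ℤ → ℤ
sumℤ = foldr ℤ._+_ (+ 0)

-- Elements of 𝒵_n: coefficient functions (only values on comps n matter)
Elem : Set
Elem = List ℕ → ℤ

module _ (n : ℕ) where
  -- multiplication in 𝒵_n : B_q B_r = Σ_{Z ∈ S(q,r)} B_{c(Z)}
  _⋆_ : Elem → Elem → Elem
  (x ⋆ y) w = sumℤ (concatMap (λ q → map (λ r → x q ℤ.* y r ℤ.* + count q r w) (comps n)) (comps n))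

  _⊖_ : Elem → Elem → Elem
  (x ⊖ y) w = x w ℤ.- y w

  𝟙 : Elem
  𝟙 w = if does (≡-dec ℕ._≟_ w (n ∷ [])) then + 1 else + 0

  -- equality in Σ(n,p) = 𝒵_n / p𝒵_n
  _≈[_]_ : Elem → ℕ → Elem → Set
  x ≈[ p ] y = ∀ w → w ∈ comps n → (+ p) ∣ℤ (x w ℤ.- y w)

  -- Jacobson radical 𝓡(n,p) of Σ(n,p): x such that 1 - a x is left invertible for all a
  InRadical : ℕ → Elem → Set
  InRadical p x = ∀ (a : Elem) → Σ Elem (λ b → (b ⋆ (𝟙 ⊖ (a ⋆ x))) ≈[ p ] 𝟙)

-- For compositions q and v of n, let mark q v count the ways of distributing the parts of q
-- among the entries of v so that every entry is filled exactly.  Placing a part into an entry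
-- of a matrix Z ∈ S(s,t) amounts to placing it into a row sum and a column sum, which gives
-- ∑_{Z ∈ S(s,t)} mark q (c Z) = mark q s · mark q t; hence χ_q(x) = ∑_r x_r · mark q r is a
-- ring homomorphism 𝒵_n → ℤ and vanishes on a(xy − yx).  The product is also triangular for
-- the length: since c Z refines q for every Z ∈ S(q,r), the coefficient of B_w in B_q B_r is
-- δ_{qw} · mark q r whenever ℓ(w) ≤ ℓ(q).  So multiplying by an element d killed by every χ_q
-- raises the least length in the support by one, d^(n+1) = 0, and 1 + d + ⋯ + d^n is a left
-- inverse of 1 − d.  All of this happens in 𝒵_n itself.

module Submission where

open import Defs
open import Level using (Level)
open import Algebra.Bundles using (CommutativeSemiring)
open import Data.List using (List; []; _∷_; _++_; map; concatMap; applyUpTo; length)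
open import Data.List.Relation.Unary.All using (All; []; _∷_)
open import Data.Nat as ℕ using (ℕ; zero; suc; _<_; z≤n; s≤s)
open import Data.Nat.Properties using (suc-injective)
open import Relation.Binary.PropositionalEquality using (_≢_)

module ListSum {c ℓ} (R : CommutativeSemiring c ℓ) where

  open CommutativeSemiring R
  open import Relation.Binary.Reasoning.Setoid setoid
  open import Algebra.Properties.CommutativeSemigroup +-commutativeSemigroup using (interchange)
  open import Algebra.Properties.CommutativeSemigroup *-commutativeSemigroup using (x∙yz≈y∙xz)

  private variable
    a b : Level
    A : Set a
    B : Set b

  ∑ : List A → (A → Carrier) → Carrier
  ∑ []       f = 0#
  ∑ (x ∷ xs) f = f x + ∑ xs f

  ∑-cong : ∀ xs {f g : A → Carrier} → (∀ x → f x ≈ g x) → ∑ xs f ≈ ∑ xs g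
  ∑-cong []       f≈g = refl
  ∑-cong (x ∷ xs) f≈g = +-cong (f≈g x) (∑-cong xs f≈g)

  ∑-cong-All : ∀ {p} {P : A → Set p} {xs} {f g : A → Carrier} →
               All P xs → (∀ x → P x → f x ≈ g x) → ∑ xs f ≈ ∑ xs g
  ∑-cong-All []         f≈g = refl
  ∑-cong-All (px ∷ pxs) f≈g = +-cong (f≈g _ px) (∑-cong-All pxs f≈g)

  ∑-zero : ∀ (xs : List A) → ∑ xs (λ _ → 0#) ≈ 0#
  ∑-zero []       = refl
  ∑-zero (x ∷ xs) = trans (+-identityˡ _) (∑-zero xs)

  ∑-++ : ∀ xs ys (f : A → Carrier) → ∑ (xs ++ ys) f ≈ ∑ xs f + ∑ ys f
  ∑-++ []       ys f = sym (+-identityˡ _)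
  ∑-++ (x ∷ xs) ys f = trans (+-congˡ (∑-++ xs ys f)) (sym (+-assoc _ _ _))

  ∑-distrib-+ : ∀ xs (f g : A → Carrier) → ∑ xs (λ x → f x + g x) ≈ ∑ xs f + ∑ xs g
  ∑-distrib-+ []       f g = sym (+-identityˡ _)
  ∑-distrib-+ (x ∷ xs) f g = trans (+-congˡ (∑-distrib-+ xs f g)) (interchange _ _ _ _)

  ∑-distribˡ-* : ∀ xs k (f : A → Carrier) → ∑ xs (λ x → k * f x) ≈ k * ∑ xs f
  ∑-distribˡ-* []       k f = sym (zeroʳ k)
  ∑-distribˡ-* (x ∷ xs) k f = trans (+-congˡ (∑-distribˡ-* xs k f)) (sym (distribˡ k _ _))

  ∑-distribʳ-* : ∀ xs k (f : A → Carrier) → ∑ xs (λ x → f x * k) ≈ ∑ xs f * k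
  ∑-distribʳ-* xs k f = begin
    ∑ xs (λ x → f x * k) ≈⟨ ∑-cong xs (λ x → *-comm (f x) k) ⟩
    ∑ xs (λ x → k * f x) ≈⟨ ∑-distribˡ-* xs k f ⟩
    k * ∑ xs f           ≈⟨ *-comm k _ ⟩
    ∑ xs f * k           ∎

  ∑-comm : ∀ xs (ys : List B) (f : A → B → Carrier) →
           ∑ xs (λ x → ∑ ys (f x)) ≈ ∑ ys (λ y → ∑ xs (λ x → f x y))
  ∑-comm []       ys f = sym (∑-zero ys)
  ∑-comm (x ∷ xs) ys f = trans (+-congˡ (∑-comm xs ys f)) (sym (∑-distrib-+ ys (f x) _))

  ∑-pull-* : ∀ xs x k (f : A → Carrier) → x * ∑ xs (λ y → k * f y) ≈ k * (x * ∑ xs f)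
  ∑-pull-* xs x k f = trans (*-congˡ (∑-distribˡ-* xs k f)) (x∙yz≈y∙xz x k (∑ xs f))

  ∑-map : ∀ (g : B → A) xs (f : A → Carrier) → ∑ (map g xs) f ≈ ∑ xs (λ x → f (g x))
  ∑-map g []       f = refl
  ∑-map g (x ∷ xs) f = +-congˡ (∑-map g xs f)

  ∑-concatMap : ∀ (g : B → List A) xs (f : A → Carrier) →
                ∑ (concatMap g xs) f ≈ ∑ xs (λ x → ∑ (g x) f)
  ∑-concatMap g []       f = refl
  ∑-concatMap g (x ∷ xs) f = trans (∑-++ (g x) _ f) (+-congˡ (∑-concatMap g xs f))

  ∑< : ℕ → (ℕ → Carrier) → Carrier
  ∑< zero    f = 0#
  ∑< (suc n) f = f 0 + ∑< n (λ i → f (suc i))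

  ∑-applyUpTo : ∀ (g : ℕ → A) n f → ∑ (applyUpTo g n) f ≈ ∑< n (λ i → f (g i))
  ∑-applyUpTo g zero    f = refl
  ∑-applyUpTo g (suc n) f = +-congˡ (∑-applyUpTo (λ i → g (suc i)) n f)

  ∑<-cong : ∀ n {f g} → (∀ i → i < n → f i ≈ g i) → ∑< n f ≈ ∑< n g
  ∑<-cong zero    f≈g = refl
  ∑<-cong (suc n) f≈g = +-cong (f≈g 0 (s≤s z≤n)) (∑<-cong n (λ i i<n → f≈g (suc i) (s≤s i<n)))

  ∑<-zero : ∀ n {f} → (∀ i → i < n → f i ≈ 0#) → ∑< n f ≈ 0#
  ∑<-zero zero    f≈0 = refl
  ∑<-zero (suc n) f≈0 =
    trans (+-cong (f≈0 0 (s≤s z≤n)) (∑<-zero n (λ i i<n → f≈0 (suc i) (s≤s i<n)))) (+-identityˡ 0#)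

  ∑<-split : ∀ m k f → ∑< (m ℕ.+ k) f ≈ ∑< m f + ∑< k (λ i → f (m ℕ.+ i))
  ∑<-split zero    k f = sym (+-identityˡ _)
  ∑<-split (suc m) k f = trans (+-congˡ (∑<-split m k (λ i → f (suc i)))) (sym (+-assoc _ _ _))

  ∑<-single : ∀ n k f → k < n → (∀ i → i < n → i ≢ k → f i ≈ 0#) → ∑< n f ≈ f k
  ∑<-single (suc n) zero f _ f≈0 =
    trans (+-congˡ (∑<-zero n (λ i i<n → f≈0 (suc i) (s≤s i<n) (λ ())))) (+-identityʳ _)
  ∑<-single (suc n) (suc k) f (s≤s k<n) f≈0 =
    trans (+-cong (f≈0 0 (s≤s z≤n) (λ ())) (∑<-single n k (λ i → f (suc i)) k<n
            (λ i i<n i≢k → f≈0 (suc i) (s≤s i<n) (λ eq → i≢k (suc-injective eq)))))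
          (+-identityˡ _)

  ∑<-distrib-+ : ∀ n f g → ∑< n (λ i → f i + g i) ≈ ∑< n f + ∑< n g
  ∑<-distrib-+ zero    f g = sym (+-identityˡ _)
  ∑<-distrib-+ (suc n) f g = trans (+-congˡ (∑<-distrib-+ n _ _)) (interchange _ _ _ _)

  ∑<-distribˡ-* : ∀ n k f → ∑< n (λ i → k * f i) ≈ k * ∑< n f
  ∑<-distribˡ-* zero    k f = sym (zeroʳ k)
  ∑<-distribˡ-* (suc n) k f = trans (+-congˡ (∑<-distribˡ-* n k _)) (sym (distribˡ k _ _))

  ∑<-comm-∑ : ∀ n xs (f : ℕ → A → Carrier) →
              ∑< n (λ i → ∑ xs (f i)) ≈ ∑ xs (λ x → ∑< n (λ i → f i x))
  ∑<-comm-∑ zero    xs f = sym (∑-zero xs)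
  ∑<-comm-∑ (suc n) xs f = trans (+-congˡ (∑<-comm-∑ n xs _)) (sym (∑-distrib-+ xs (f 0) _))

module Marks where

  open import Data.Bool using (Bool; true; false; _∧_; if_then_else_)
  open import Data.List using (concat; zipWith; upTo; filter)
  open import Data.List.Properties using (≡-dec; ∷-injectiveˡ; ∷-injectiveʳ; length-++; ++-assoc)
  import Data.List.Relation.Unary.All as All
  import Data.List.Relation.Unary.All.Properties as Allₚ
  open import Data.Nat using (_+_; _*_; _∸_; _≤_; _≤?_; _≟_)
  open import Data.Nat.ListAction using (sum)
  open import Data.Nat.ListAction.Properties using (sum-++)
  open import Data.Nat.Properties
  open import Data.Product using (_×_; _,_)
  open import Function using (_∘_)
  open import Relation.Binary.PropositionalEquality hiding ([_])
  open import Relation.Nullary using (Dec; yes; no; does; ¬_; contradiction)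
  open import Relation.Nullary.Decidable using (_×-dec_)

  open ListSum +-*-commutativeSemiring
  open import Algebra.Properties.CommutativeSemigroup *-commutativeSemigroup using (x∙yz≈y∙xz)

  𝕀 : Bool → ℕ
  𝕀 true  = 1
  𝕀 false = 0

  private variable
    a ℓ : Level
    A : Set a
    P Q R : Set ℓ

  𝕀-yes : (P? : Dec P) → P → 𝕀 (does P?) ≡ 1
  𝕀-yes (yes _) _  = refl
  𝕀-yes (no ¬p) p = contradiction p ¬p

  𝕀-no : (P? : Dec P) → ¬ P → 𝕀 (does P?) ≡ 0
  𝕀-no (yes p) ¬p = contradiction p ¬p
  𝕀-no (no _)  _  = refl

  𝕀-⇔ : (P? : Dec P) (Q? : Dec Q) → (P → Q) → (Q → P) → 𝕀 (does P?) ≡ 𝕀 (does Q?)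
  𝕀-⇔ (yes p) Q? f g = sym (𝕀-yes Q? (f p))
  𝕀-⇔ (no ¬p) Q? f g = sym (𝕀-no Q? (λ q → ¬p (g q)))

  𝕀-∧ : ∀ b c → 𝕀 (b ∧ c) ≡ 𝕀 b * 𝕀 c
  𝕀-∧ true  c = sym (+-identityʳ (𝕀 c))
  𝕀-∧ false c = refl

  𝕀-× : (P? : Dec P) (Q? : Dec Q) (R? : Dec R) →
        (P → Q × R) → (Q × R → P) → 𝕀 (does P?) ≡ 𝕀 (does Q?) * 𝕀 (does R?)
  𝕀-× P? Q? R? f g = trans (𝕀-⇔ P? (Q? ×-dec R?) f g) (𝕀-∧ (does Q?) (does R?))

  ∑-if : ∀ b (xs : List A) f → ∑ (if b then xs else []) f ≡ 𝕀 b * ∑ xs f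
  ∑-if true  xs f = sym (*-identityˡ _)
  ∑-if false xs f = refl

  length-filter : ∀ {P : A → Set ℓ} (P? : ∀ x → Dec (P x)) xs →
                  length (filter P? xs) ≡ ∑ xs (λ x → 𝕀 (does (P? x)))
  length-filter P? []       = refl
  length-filter P? (x ∷ xs) with does (P? x)
  ... | true  = cong suc (length-filter P? xs)
  ... | false = length-filter P? xs

  [_≤_] : ℕ → ℕ → ℕ
  [ m ≤ n ] = 𝕀 (does (m ≤? n))

  infix 4 _≟ₗ_
  _≟ₗ_ : (v w : List ℕ) → Dec (v ≡ w)
  _≟ₗ_ = ≡-dec _≟_

  δ : List ℕ → List ℕ → ℕ
  δ v w = 𝕀 (does (v ≟ₗ w))

  δ-sym : ∀ v w → δ v w ≡ δ w v
  δ-sym v w = 𝕀-⇔ (v ≟ₗ w) (w ≟ₗ v) sym sym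

  δ-∷ : ∀ x v w → δ (x ∷ v) (x ∷ w) ≡ δ v w
  δ-∷ x v w = 𝕀-⇔ (x ∷ v ≟ₗ x ∷ w) (v ≟ₗ w) ∷-injectiveʳ (cong (x ∷_))

  δ-*-subst : ∀ v w (g : List ℕ → ℕ) → δ v w * g w ≡ δ v w * g v
  δ-*-subst v w g with v ≟ₗ w
  ... | yes refl = refl
  ... | no  _    = refl

  count-∑ : ∀ q r w → count q r w ≡ ∑ (S q r) (λ Z → δ (c Z) w)
  count-∑ q r w = length-filter (λ Z → c Z ≟ₗ w) (S q r)

  -- Sums over rowsFor and S

  infixl 6 _⊝_
  _⊝_ : List ℕ → List ℕ → List ℕ
  _⊝_ = zipWith _∸_

  ∑-rowsFor-∷ : ∀ b bs s (F : List ℕ → ℕ) →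
    ∑ (rowsFor (b ∷ bs) s) F ≡ ∑< (suc b) (λ z → [ z ≤ s ] * ∑ (rowsFor bs (s ∸ z)) (λ row → F (z ∷ row)))
  ∑-rowsFor-∷ b bs s F = begin
    ∑ (rowsFor (b ∷ bs) s) F                    ≡⟨ ∑-concatMap rowsFrom (range 0 b) F ⟩
    ∑ (range 0 b) (λ z → ∑ (rowsFrom z) F)      ≡⟨ ∑-map (0 +_) (upTo (suc b)) _ ⟩
    ∑ (upTo (suc b)) (λ z → ∑ (rowsFrom z) F)   ≡⟨ ∑-applyUpTo (λ i → i) (suc b) _ ⟩
    ∑< (suc b) (λ z → ∑ (rowsFrom z) F)         ≡⟨ ∑<-cong (suc b) (λ z _ → first-entry z) ⟩
    ∑< (suc b) (λ z → [ z ≤ s ] * ∑ (rowsFor bs (s ∸ z)) (λ row → F (z ∷ row))) ∎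
    where
    open ≡-Reasoning
    rowsFrom : ℕ → List (List ℕ)
    rowsFrom z = if does (z ≤? s) then map (z ∷_) (rowsFor bs (s ∸ z)) else []
    first-entry : ∀ z → ∑ (rowsFrom z) F ≡ [ z ≤ s ] * ∑ (rowsFor bs (s ∸ z)) (λ row → F (z ∷ row))
    first-entry z = trans (∑-if (does (z ≤? s)) _ F) (cong ([ z ≤ s ] *_) (∑-map (z ∷_) (rowsFor bs (s ∸ z)) F))

  ∑-S-∷ : ∀ a q t (G : List (List ℕ) → ℕ) →
    ∑ (S (a ∷ q) t) G ≡ ∑ (rowsFor t a) (λ row → ∑ (S q (t ⊝ row)) (λ Z → G (row ∷ Z)))
  ∑-S-∷ a q t G = trans (∑-concatMap (λ row → map (row ∷_) (S q (t ⊝ row))) (rowsFor t a) G)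
                        (∑-cong (rowsFor t a) (λ row → ∑-map (row ∷_) (S q (t ⊝ row)) G))

  ∑<-≤-from : ∀ a b (h : ℕ → ℕ) →
    ∑< (suc b) (λ z → [ a ≤ z ] * h z) ≡ [ a ≤ b ] * ∑< (suc (b ∸ a)) (λ z → h (a + z))
  ∑<-≤-from a b h with a ≤? b
  ... | no a≰b = trans (∑<-zero (suc b) {λ z → [ a ≤ z ] * h z}
                          (λ z z≤b → cong (_* h z) (𝕀-no (a ≤? z) (λ a≤z → a≰b (≤-trans a≤z (≤-pred z≤b))))))
                       (cong (_* ∑< (suc (b ∸ a)) (λ z → h (a + z))) (sym (𝕀-no (a ≤? b) a≰b)))
  ... | yes a≤b = begin
    ∑< (suc b) f                                 ≡⟨ cong (λ m → ∑< m f) (sym (trans (+-suc a (b ∸ a)) (cong suc (m+[n∸m]≡n a≤b)))) ⟩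
    ∑< (a + suc (b ∸ a)) f                       ≡⟨ ∑<-split a (suc (b ∸ a)) f ⟩
    ∑< a f + ∑< (suc (b ∸ a)) (λ i → f (a + i))  ≡⟨ cong₂ _+_ below-a from-a ⟩
    tail                                         ≡⟨ sym (*-identityˡ tail) ⟩
    1 * tail                                     ≡⟨ cong (_* tail) (sym (𝕀-yes (a ≤? b) a≤b)) ⟩
    [ a ≤ b ] * tail                     ∎
    where
    open ≡-Reasoning
    f : ℕ → ℕ
    f z = [ a ≤ z ] * h z
    tail : ℕ
    tail = ∑< (suc (b ∸ a)) (λ i → h (a + i))
    below-a : ∑< a f ≡ 0
    below-a = ∑<-zero a (λ z z<a → cong (_* h z) (𝕀-no (a ≤? z) (<⇒≱ z<a)))
    from-a : ∑< (suc (b ∸ a)) (λ i → f (a + i)) ≡ tail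
    from-a = ∑<-cong (suc (b ∸ a)) (λ i _ →
      trans (cong (_* h (a + i)) (𝕀-yes (a ≤? a + i) (m≤m+n a i))) (*-identityˡ (h (a + i))))

  ∑<-≤-∸ : ∀ a b (g : ℕ → ℕ) →
    ∑< (suc b) (λ z → [ a ≤ b ∸ z ] * g z) ≡ [ a ≤ b ] * ∑< (suc (b ∸ a)) g
  ∑<-≤-∸ a b g with a ≤? b
  ... | no a≰b = trans (∑<-zero (suc b) {λ z → [ a ≤ b ∸ z ] * g z}
                          (λ z _ → cong (_* g z) (𝕀-no (a ≤? b ∸ z) (λ a≤ → a≰b (≤-trans a≤ (m∸n≤m b z))))))
                       (cong (_* ∑< (suc (b ∸ a)) g) (sym (𝕀-no (a ≤? b) a≰b)))
  ... | yes a≤b = begin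
    ∑< (suc b) f                                            ≡⟨ cong (λ m → ∑< m f) (cong suc (sym (m∸n+n≡m a≤b))) ⟩
    ∑< (suc (b ∸ a) + a) f                                  ≡⟨ ∑<-split (suc (b ∸ a)) a f ⟩
    ∑< (suc (b ∸ a)) f + ∑< a (λ i → f (suc (b ∸ a) + i))  ≡⟨ cong₂ _+_ head-part tail-part ⟩
    ∑< (suc (b ∸ a)) g + 0                                  ≡⟨ +-identityʳ _ ⟩
    ∑< (suc (b ∸ a)) g                                      ≡⟨ sym (*-identityˡ (∑< (suc (b ∸ a)) g)) ⟩
    1 * ∑< (suc (b ∸ a)) g                                  ≡⟨ cong (_* ∑< (suc (b ∸ a)) g) (sym (𝕀-yes (a ≤? b) a≤b)) ⟩
    [ a ≤ b ] * ∑< (suc (b ∸ a)) g                 ∎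
    where
    open ≡-Reasoning
    f : ℕ → ℕ
    f z = [ a ≤ b ∸ z ] * g z
    fits : ∀ z → z < suc (b ∸ a) → a ≤ b ∸ z
    fits z z≤ = m+n≤o⇒m≤o∸n a (subst (_≤ b) (+-comm z a) (subst (z + a ≤_) (m∸n+n≡m a≤b) (+-monoˡ-≤ a (≤-pred z≤))))
    head-part : ∑< (suc (b ∸ a)) f ≡ ∑< (suc (b ∸ a)) g
    head-part = ∑<-cong (suc (b ∸ a)) (λ z z≤ → trans (cong (_* g z) (𝕀-yes (a ≤? b ∸ z) (fits z z≤))) (*-identityˡ (g z)))
    overflows : ∀ i → i < a → ¬ (a ≤ b ∸ (suc (b ∸ a) + i))
    overflows i i<a a≤ = <⇒≱ b<a+k (m≤o∸n⇒m+n≤o a (<⇒≤ k<b) a≤)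
      where
      k = suc (b ∸ a) + i
      k<b : k < b
      k<b = m∸n≢0⇒n<m (λ b∸k≡0 → <⇒≱ (≤-trans (s≤s z≤n) i<a) (subst (a ≤_) b∸k≡0 a≤))
      b<a+k : b < a + k
      b<a+k = subst (_< a + k) (m+[n∸m]≡n a≤b)
                (≤-trans (≤-reflexive (sym (+-suc a (b ∸ a)))) (+-monoʳ-≤ a (s≤s (m≤m+n (b ∸ a) i))))
    tail-part : ∑< a (λ i → f (suc (b ∸ a) + i)) ≡ 0
    tail-part = ∑<-zero a (λ i i<a → cong (_* g (suc (b ∸ a) + i)) (𝕀-no (a ≤? b ∸ (suc (b ∸ a) + i)) (overflows i i<a)))

  -- Placements and marks

  placements : ℕ → List ℕ → List (List ℕ)
  placements a []       = []
  placements a (x ∷ xs) =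
    (if does (a ≤? x) then ((x ∸ a) ∷ xs) ∷ [] else []) ++ map (x ∷_) (placements a xs)

  ∑-placements-∷ : ∀ a x xs (F : List ℕ → ℕ) →
    ∑ (placements a (x ∷ xs)) F ≡ [ a ≤ x ] * F ((x ∸ a) ∷ xs) + ∑ (placements a xs) (λ v → F (x ∷ v))
  ∑-placements-∷ a x xs F = begin
    ∑ (placements a (x ∷ xs)) F
      ≡⟨ ∑-++ (if does (a ≤? x) then ((x ∸ a) ∷ xs) ∷ [] else []) (map (x ∷_) (placements a xs)) F ⟩
    ∑ (if does (a ≤? x) then ((x ∸ a) ∷ xs) ∷ [] else []) F + ∑ (map (x ∷_) (placements a xs)) F
      ≡⟨ cong₂ _+_ (trans (∑-if (does (a ≤? x)) (((x ∸ a) ∷ xs) ∷ []) F)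
                          (cong ([ a ≤ x ] *_) (+-identityʳ (F ((x ∸ a) ∷ xs)))))
                   (∑-map (x ∷_) (placements a xs) F) ⟩
    [ a ≤ x ] * F ((x ∸ a) ∷ xs) + ∑ (placements a xs) (λ v → F (x ∷ v)) ∎
    where open ≡-Reasoning

  m∸n∸o≡m∸o∸n : ∀ m n o → m ∸ n ∸ o ≡ m ∸ o ∸ n
  m∸n∸o≡m∸o∸n m n o = trans (∸-+-assoc m n o) (trans (cong (m ∸_) (+-comm n o)) (sym (∸-+-assoc m o n)))

  𝕀-+≤ : ∀ a z s → [ a + z ≤ s ] ≡ [ a ≤ s ] * [ z ≤ s ∸ a ]
  𝕀-+≤ a z s = 𝕀-× (a + z ≤? s) (a ≤? s) (z ≤? s ∸ a)
    (λ a+z≤s → m+n≤o⇒m≤o a a+z≤s , m+n≤o⇒m≤o∸n z (subst (_≤ s) (+-comm a z) a+z≤s))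
    (λ (a≤s , z≤s∸a) → subst (_≤ s) (+-comm z a) (m≤o∸n⇒m+n≤o z a≤s z≤s∸a))

  ∑-rowsFor-placements-⊝ : ∀ a t s (H : List ℕ → List ℕ → ℕ) →
    ∑ (rowsFor t s) (λ row → ∑ (placements a (t ⊝ row)) (H row)) ≡
    ∑ (placements a t) (λ t′ → ∑ (rowsFor t′ s) (λ row → H row (t′ ⊝ row)))
  ∑-rowsFor-placements-⊝ a []       zero    H = refl
  ∑-rowsFor-placements-⊝ a []       (suc s) H = refl
  ∑-rowsFor-placements-⊝ a (b ∷ bs) s       H = begin
    ∑ (rowsFor (b ∷ bs) s) (λ row → ∑ (placements a ((b ∷ bs) ⊝ row)) (H row))
      ≡⟨ ∑-rowsFor-∷ b bs s (λ row → ∑ (placements a ((b ∷ bs) ⊝ row)) (H row)) ⟩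
    ∑< (suc b) (λ z → [ z ≤ s ] * ∑ (rows z) (λ row → ∑ (placements a ((b ∸ z) ∷ bs ⊝ row)) (H (z ∷ row))))
      ≡⟨ ∑<-cong (suc b) {g = λ z → placedInRow z + placedElsewhere z} (λ z _ → split z) ⟩
    ∑< (suc b) (λ z → placedInRow z + placedElsewhere z)
      ≡⟨ ∑<-distrib-+ (suc b) placedInRow placedElsewhere ⟩
    ∑< (suc b) placedInRow + ∑< (suc b) placedElsewhere
      ≡⟨ cong₂ _+_ inRow elsewhere ⟩
    [ a ≤ b ] * Φ ((b ∸ a) ∷ bs) + ∑ (placements a bs) (λ v → Φ (b ∷ v))
      ≡⟨ sym (∑-placements-∷ a b bs Φ) ⟩
    ∑ (placements a (b ∷ bs)) Φ ∎
    where
    open ≡-Reasoning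
    rows : ℕ → List (List ℕ)
    rows z = rowsFor bs (s ∸ z)
    Φ : List ℕ → ℕ
    Φ t′ = ∑ (rowsFor t′ s) (λ row → H row (t′ ⊝ row))
    placedInRow placedElsewhere : ℕ → ℕ
    placedInRow z = [ z ≤ s ] *
      ∑ (rows z) (λ row → [ a ≤ b ∸ z ] * H (z ∷ row) ((b ∸ z ∸ a) ∷ bs ⊝ row))
    placedElsewhere z = [ z ≤ s ] *
      ∑ (rows z) (λ row → ∑ (placements a (bs ⊝ row)) (λ v → H (z ∷ row) ((b ∸ z) ∷ v)))
    split : ∀ z → [ z ≤ s ] * ∑ (rows z) (λ row → ∑ (placements a ((b ∸ z) ∷ bs ⊝ row)) (H (z ∷ row)))
                ≡ placedInRow z + placedElsewhere z
    split z = trans (cong ([ z ≤ s ] *_)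
                          (trans (∑-cong (rows z) (λ row → ∑-placements-∷ a (b ∸ z) (bs ⊝ row) (H (z ∷ row))))
                                 (∑-distrib-+ (rows z) (λ row → [ a ≤ b ∸ z ] * H (z ∷ row) ((b ∸ z ∸ a) ∷ bs ⊝ row))
                                                              (λ row → ∑ (placements a (bs ⊝ row)) (λ v → H (z ∷ row) ((b ∸ z) ∷ v))))))
                    (*-distribˡ-+ [ z ≤ s ] _ _)
    g : ℕ → ℕ
    g z = [ z ≤ s ] * ∑ (rows z) (λ row → H (z ∷ row) ((b ∸ a ∸ z) ∷ bs ⊝ row))
    pull : ∀ z → placedInRow z ≡ [ a ≤ b ∸ z ] * g z
    pull z = trans (∑-pull-* (rows z) [ z ≤ s ] [ a ≤ b ∸ z ] (λ row → H (z ∷ row) ((b ∸ z ∸ a) ∷ bs ⊝ row)))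
                   (cong (λ e → [ a ≤ b ∸ z ] * ([ z ≤ s ] * ∑ (rows z) (λ row → H (z ∷ row) (e ∷ bs ⊝ row))))
                         (m∸n∸o≡m∸o∸n b z a))
    inRow : ∑< (suc b) placedInRow ≡ [ a ≤ b ] * Φ ((b ∸ a) ∷ bs)
    inRow = begin
      ∑< (suc b) placedInRow
        ≡⟨ ∑<-cong (suc b) {placedInRow} (λ z _ → pull z) ⟩
      ∑< (suc b) (λ z → [ a ≤ b ∸ z ] * g z)
        ≡⟨ ∑<-≤-∸ a b g ⟩
      [ a ≤ b ] * ∑< (suc (b ∸ a)) g
        ≡⟨ cong ([ a ≤ b ] *_) (sym (∑-rowsFor-∷ (b ∸ a) bs s (λ row → H row (((b ∸ a) ∷ bs) ⊝ row)))) ⟩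
      [ a ≤ b ] * Φ ((b ∸ a) ∷ bs) ∎
    elsewhere : ∑< (suc b) placedElsewhere ≡ ∑ (placements a bs) (λ v → Φ (b ∷ v))
    elsewhere = begin
      ∑< (suc b) placedElsewhere
        ≡⟨ ∑<-cong (suc b) {placedElsewhere} (λ z _ → trans (cong ([ z ≤ s ] *_)
                                                 (∑-rowsFor-placements-⊝ a bs (s ∸ z) (λ row v → H (z ∷ row) ((b ∸ z) ∷ v))))
                                          (sym (∑-distribˡ-* (placements a bs) [ z ≤ s ] (rest z)))) ⟩
      ∑< (suc b) (λ z → ∑ (placements a bs) (term z))
        ≡⟨ ∑<-comm-∑ (suc b) (placements a bs) term ⟩
      ∑ (placements a bs) (λ v → ∑< (suc b) (λ z → term z v))
        ≡⟨ ∑-cong (placements a bs) (λ v → sym (∑-rowsFor-∷ b v s (λ row → H row ((b ∷ v) ⊝ row)))) ⟩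
      ∑ (placements a bs) (λ v → Φ (b ∷ v)) ∎
      where
      rest : ℕ → List ℕ → ℕ
      rest z v = ∑ (rowsFor v (s ∸ z)) (λ row → H (z ∷ row) ((b ∸ z) ∷ v ⊝ row))
      term : ℕ → List ℕ → ℕ
      term z v = [ z ≤ s ] * rest z v

  𝕀-≤∸-comm : ∀ z a s → [ z ≤ s ] * [ a ≤ s ∸ z ] ≡ [ a ≤ s ] * [ z ≤ s ∸ a ]
  𝕀-≤∸-comm z a s = trans (sym (𝕀-+≤ z a s)) (trans (cong (λ m → [ m ≤ s ]) (+-comm z a)) (𝕀-+≤ a z s))

  ∑-rowsFor-placements-row : ∀ a t s (K : List ℕ → List ℕ → ℕ) →
    ∑ (rowsFor t s) (λ row → ∑ (placements a row) (λ row′ → K row′ (t ⊝ row))) ≡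
    [ a ≤ s ] * ∑ (placements a t) (λ t′ → ∑ (rowsFor t′ (s ∸ a)) (λ row′ → K row′ (t′ ⊝ row′)))
  ∑-rowsFor-placements-row a []       zero    K = sym (*-zeroʳ ([ a ≤ 0 ]))
  ∑-rowsFor-placements-row a []       (suc s) K = sym (*-zeroʳ ([ a ≤ suc s ]))
  ∑-rowsFor-placements-row a (b ∷ bs) s       K = begin
    ∑ (rowsFor (b ∷ bs) s) (λ row → ∑ (placements a row) (λ row′ → K row′ ((b ∷ bs) ⊝ row)))
      ≡⟨ ∑-rowsFor-∷ b bs s (λ row → ∑ (placements a row) (λ row′ → K row′ ((b ∷ bs) ⊝ row))) ⟩
    ∑< (suc b) (λ z → [ z ≤ s ] * ∑ (rows z) (λ row → ∑ (placements a (z ∷ row)) (λ row′ → K row′ ((b ∸ z) ∷ bs ⊝ row))))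
      ≡⟨ ∑<-cong (suc b) {g = λ z → placedInRow z + placedElsewhere z} (λ z _ → split z) ⟩
    ∑< (suc b) (λ z → placedInRow z + placedElsewhere z)
      ≡⟨ ∑<-distrib-+ (suc b) placedInRow placedElsewhere ⟩
    ∑< (suc b) placedInRow + ∑< (suc b) placedElsewhere
      ≡⟨ cong₂ _+_ inRow elsewhere ⟩
    [ a ≤ s ] * ([ a ≤ b ] * Φ ((b ∸ a) ∷ bs)) + [ a ≤ s ] * ∑ (placements a bs) (λ v → Φ (b ∷ v))
      ≡⟨ sym (*-distribˡ-+ [ a ≤ s ] _ _) ⟩
    [ a ≤ s ] * ([ a ≤ b ] * Φ ((b ∸ a) ∷ bs) + ∑ (placements a bs) (λ v → Φ (b ∷ v)))
      ≡⟨ cong ([ a ≤ s ] *_) (sym (∑-placements-∷ a b bs Φ)) ⟩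
    [ a ≤ s ] * ∑ (placements a (b ∷ bs)) Φ ∎
    where
    open ≡-Reasoning
    rows : ℕ → List (List ℕ)
    rows z = rowsFor bs (s ∸ z)
    Φ : List ℕ → ℕ
    Φ t′ = ∑ (rowsFor t′ (s ∸ a)) (λ row′ → K row′ (t′ ⊝ row′))
    placedInRow placedElsewhere : ℕ → ℕ
    placedInRow z = [ z ≤ s ] *
      ∑ (rows z) (λ row → [ a ≤ z ] * K ((z ∸ a) ∷ row) ((b ∸ z) ∷ bs ⊝ row))
    placedElsewhere z = [ z ≤ s ] *
      ∑ (rows z) (λ row → ∑ (placements a row) (λ v → K (z ∷ v) ((b ∸ z) ∷ bs ⊝ row)))
    split : ∀ z → [ z ≤ s ] * ∑ (rows z) (λ row → ∑ (placements a (z ∷ row)) (λ row′ → K row′ ((b ∸ z) ∷ bs ⊝ row)))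
                ≡ placedInRow z + placedElsewhere z
    split z = trans (cong ([ z ≤ s ] *_)
                          (trans (∑-cong (rows z) (λ row → ∑-placements-∷ a z row (λ row′ → K row′ ((b ∸ z) ∷ bs ⊝ row))))
                                 (∑-distrib-+ (rows z) (λ row → [ a ≤ z ] * K ((z ∸ a) ∷ row) ((b ∸ z) ∷ bs ⊝ row))
                                                       (λ row → ∑ (placements a row) (λ v → K (z ∷ v) ((b ∸ z) ∷ bs ⊝ row))))))
                    (*-distribˡ-+ [ z ≤ s ] _ _)
    h : ℕ → ℕ
    h z = [ z ≤ s ] * ∑ (rows z) (λ row → K ((z ∸ a) ∷ row) ((b ∸ z) ∷ bs ⊝ row))
    hShifted : ℕ → ℕ
    hShifted z = [ z ≤ s ∸ a ] * ∑ (rowsFor bs (s ∸ a ∸ z)) (λ row → K (z ∷ row) ((b ∸ a ∸ z) ∷ bs ⊝ row))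
    h-shift : ∀ z → h (a + z) ≡ [ a ≤ s ] * hShifted z
    h-shift z = begin
      h (a + z)
        ≡⟨ cong₂ _*_ (𝕀-+≤ a z s) shifted-sum ⟩
      [ a ≤ s ] * [ z ≤ s ∸ a ] * ∑ (rowsFor bs (s ∸ a ∸ z)) (λ row → K (z ∷ row) ((b ∸ a ∸ z) ∷ bs ⊝ row))
        ≡⟨ *-assoc [ a ≤ s ] _ _ ⟩
      [ a ≤ s ] * hShifted z ∎
      where
      shifted-sum : ∑ (rows (a + z)) (λ row → K ((a + z ∸ a) ∷ row) ((b ∸ (a + z)) ∷ bs ⊝ row))
                  ≡ ∑ (rowsFor bs (s ∸ a ∸ z)) (λ row → K (z ∷ row) ((b ∸ a ∸ z) ∷ bs ⊝ row))
      shifted-sum rewrite m+n∸m≡n a z | sym (∸-+-assoc s a z) | sym (∸-+-assoc b a z) = refl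
    inRow : ∑< (suc b) placedInRow ≡ [ a ≤ s ] * ([ a ≤ b ] * Φ ((b ∸ a) ∷ bs))
    inRow = begin
      ∑< (suc b) placedInRow
        ≡⟨ ∑<-cong (suc b) {placedInRow} (λ z _ → ∑-pull-* (rows z) [ z ≤ s ] [ a ≤ z ] (λ row → K ((z ∸ a) ∷ row) ((b ∸ z) ∷ bs ⊝ row))) ⟩
      ∑< (suc b) (λ z → [ a ≤ z ] * h z)
        ≡⟨ ∑<-≤-from a b h ⟩
      [ a ≤ b ] * ∑< (suc (b ∸ a)) (λ z → h (a + z))
        ≡⟨ cong ([ a ≤ b ] *_) (trans (∑<-cong (suc (b ∸ a)) {λ z → h (a + z)} (λ z _ → h-shift z))
                                              (∑<-distribˡ-* (suc (b ∸ a)) [ a ≤ s ] hShifted)) ⟩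
      [ a ≤ b ] * ([ a ≤ s ] * ∑< (suc (b ∸ a)) hShifted)
        ≡⟨ x∙yz≈y∙xz [ a ≤ b ] [ a ≤ s ] _ ⟩
      [ a ≤ s ] * ([ a ≤ b ] * ∑< (suc (b ∸ a)) hShifted)
        ≡⟨ cong (λ e → [ a ≤ s ] * ([ a ≤ b ] * e))
                (sym (∑-rowsFor-∷ (b ∸ a) bs (s ∸ a) (λ row → K row (((b ∸ a) ∷ bs) ⊝ row)))) ⟩
      [ a ≤ s ] * ([ a ≤ b ] * Φ ((b ∸ a) ∷ bs)) ∎
    rest : ℕ → ℕ → List ℕ → ℕ
    rest z m v = ∑ (rowsFor v m) (λ row′ → K (z ∷ row′) ((b ∸ z) ∷ v ⊝ row′))
    term : ℕ → List ℕ → ℕ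
    term z v = [ z ≤ s ∸ a ] * rest z (s ∸ a ∸ z) v
    elsewhere-at : ∀ z → placedElsewhere z ≡ [ a ≤ s ] * ∑ (placements a bs) (term z)
    elsewhere-at z = begin
      placedElsewhere z
        ≡⟨ cong ([ z ≤ s ] *_) (∑-rowsFor-placements-row a bs (s ∸ z) (λ v u → K (z ∷ v) ((b ∸ z) ∷ u))) ⟩
      [ z ≤ s ] * ([ a ≤ s ∸ z ] * ∑ (placements a bs) (rest z (s ∸ z ∸ a)))
        ≡⟨ sym (*-assoc [ z ≤ s ] _ _) ⟩
      [ z ≤ s ] * [ a ≤ s ∸ z ] * ∑ (placements a bs) (rest z (s ∸ z ∸ a))
        ≡⟨ cong₂ _*_ (𝕀-≤∸-comm z a s) (cong (λ m → ∑ (placements a bs) (rest z m)) (m∸n∸o≡m∸o∸n s z a)) ⟩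
      [ a ≤ s ] * [ z ≤ s ∸ a ] * ∑ (placements a bs) (rest z (s ∸ a ∸ z))
        ≡⟨ *-assoc [ a ≤ s ] _ _ ⟩
      [ a ≤ s ] * ([ z ≤ s ∸ a ] * ∑ (placements a bs) (rest z (s ∸ a ∸ z)))
        ≡⟨ cong ([ a ≤ s ] *_) (sym (∑-distribˡ-* (placements a bs) [ z ≤ s ∸ a ] (rest z (s ∸ a ∸ z)))) ⟩
      [ a ≤ s ] * ∑ (placements a bs) (term z) ∎
    elsewhere : ∑< (suc b) placedElsewhere ≡ [ a ≤ s ] * ∑ (placements a bs) (λ v → Φ (b ∷ v))
    elsewhere = begin
      ∑< (suc b) placedElsewhere
        ≡⟨ ∑<-cong (suc b) {placedElsewhere} (λ z _ → elsewhere-at z) ⟩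
      ∑< (suc b) (λ z → [ a ≤ s ] * ∑ (placements a bs) (term z))
        ≡⟨ ∑<-distribˡ-* (suc b) [ a ≤ s ] (λ z → ∑ (placements a bs) (term z)) ⟩
      [ a ≤ s ] * ∑< (suc b) (λ z → ∑ (placements a bs) (term z))
        ≡⟨ cong ([ a ≤ s ] *_) (trans (∑<-comm-∑ (suc b) (placements a bs) term)
             (∑-cong (placements a bs) (λ v → sym (∑-rowsFor-∷ b v (s ∸ a) (λ row′ → K row′ ((b ∷ v) ⊝ row′)))))) ⟩
      [ a ≤ s ] * ∑ (placements a bs) (λ v → Φ (b ∷ v)) ∎

  placementsM : ℕ → List (List ℕ) → List (List (List ℕ))
  placementsM a []        = []
  placementsM a (row ∷ Z) = map (_∷ Z) (placements a row) ++ map (row ∷_) (placementsM a Z)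

  ∑-placementsM-∷ : ∀ a row Z (G : List (List ℕ) → ℕ) →
    ∑ (placementsM a (row ∷ Z)) G ≡ ∑ (placements a row) (λ r → G (r ∷ Z)) + ∑ (placementsM a Z) (λ Z′ → G (row ∷ Z′))
  ∑-placementsM-∷ a row Z G =
    trans (∑-++ (map (_∷ Z) (placements a row)) _ G)
          (cong₂ _+_ (∑-map (_∷ Z) (placements a row) G) (∑-map (row ∷_) (placementsM a Z) G))

  ∑-S-placementsM : ∀ a s t (G : List (List ℕ) → ℕ) →
    ∑ (S s t) (λ Z → ∑ (placementsM a Z) G) ≡ ∑ (placements a s) (λ s′ → ∑ (placements a t) (λ t′ → ∑ (S s′ t′) G))
  ∑-S-placementsM a [] t G with allZero t
  ... | true  = refl
  ... | false = refl
  ∑-S-placementsM a (s₀ ∷ s) t G = begin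
    ∑ (S (s₀ ∷ s) t) (λ Z → ∑ (placementsM a Z) G)
      ≡⟨ ∑-S-∷ s₀ s t (λ Z → ∑ (placementsM a Z) G) ⟩
    ∑ (rowsFor t s₀) (λ row → ∑ (S s (t ⊝ row)) (λ Z → ∑ (placementsM a (row ∷ Z)) G))
      ≡⟨ ∑-cong (rowsFor t s₀) (λ row → trans (∑-cong (S s (t ⊝ row)) (λ Z → ∑-placementsM-∷ a row Z G))
                                              (∑-distrib-+ (S s (t ⊝ row)) _ _)) ⟩
    ∑ (rowsFor t s₀) (λ row → inRow row + elsewhere row)
      ≡⟨ ∑-distrib-+ (rowsFor t s₀) inRow elsewhere ⟩
    ∑ (rowsFor t s₀) inRow + ∑ (rowsFor t s₀) elsewhere
      ≡⟨ cong₂ _+_ placedInFirstRow placedInLaterRows ⟩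
    [ a ≤ s₀ ] * Ψ ((s₀ ∸ a) ∷ s) + ∑ (placements a s) (λ s′ → Ψ (s₀ ∷ s′))
      ≡⟨ sym (∑-placements-∷ a s₀ s Ψ) ⟩
    ∑ (placements a (s₀ ∷ s)) Ψ ∎
    where
    open ≡-Reasoning
    Ψ : List ℕ → ℕ
    Ψ s′ = ∑ (placements a t) (λ t′ → ∑ (S s′ t′) G)
    inRow elsewhere : List ℕ → ℕ
    inRow row     = ∑ (S s (t ⊝ row)) (λ Z → ∑ (placements a row) (λ r → G (r ∷ Z)))
    elsewhere row = ∑ (S s (t ⊝ row)) (λ Z → ∑ (placementsM a Z) (λ Z′ → G (row ∷ Z′)))
    placedInFirstRow : ∑ (rowsFor t s₀) inRow ≡ [ a ≤ s₀ ] * Ψ ((s₀ ∸ a) ∷ s)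
    placedInFirstRow = begin
      ∑ (rowsFor t s₀) inRow
        ≡⟨ ∑-cong (rowsFor t s₀) (λ row → ∑-comm (S s (t ⊝ row)) (placements a row) (λ Z r → G (r ∷ Z))) ⟩
      ∑ (rowsFor t s₀) (λ row → ∑ (placements a row) (λ r → ∑ (S s (t ⊝ row)) (λ Z → G (r ∷ Z))))
        ≡⟨ ∑-rowsFor-placements-row a t s₀ (λ r u → ∑ (S s u) (λ Z → G (r ∷ Z))) ⟩
      [ a ≤ s₀ ] * ∑ (placements a t) (λ t′ → ∑ (rowsFor t′ (s₀ ∸ a)) (λ r → ∑ (S s (t′ ⊝ r)) (λ Z → G (r ∷ Z))))
        ≡⟨ cong ([ a ≤ s₀ ] *_) (∑-cong (placements a t) (λ t′ → sym (∑-S-∷ (s₀ ∸ a) s t′ G))) ⟩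
      [ a ≤ s₀ ] * Ψ ((s₀ ∸ a) ∷ s) ∎
    placedInLaterRows : ∑ (rowsFor t s₀) elsewhere ≡ ∑ (placements a s) (λ s′ → Ψ (s₀ ∷ s′))
    placedInLaterRows = begin
      ∑ (rowsFor t s₀) elsewhere
        ≡⟨ ∑-cong (rowsFor t s₀) (λ row → ∑-S-placementsM a s (t ⊝ row) (λ Z′ → G (row ∷ Z′))) ⟩
      ∑ (rowsFor t s₀) (λ row → ∑ (placements a s) (λ s′ → ∑ (placements a (t ⊝ row)) (λ t″ → ∑ (S s′ t″) (λ Z′ → G (row ∷ Z′)))))
        ≡⟨ ∑-comm (rowsFor t s₀) (placements a s) _ ⟩
      ∑ (placements a s) (λ s′ → ∑ (rowsFor t s₀) (λ row → ∑ (placements a (t ⊝ row)) (λ t″ → ∑ (S s′ t″) (λ Z′ → G (row ∷ Z′)))))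
        ≡⟨ ∑-cong (placements a s) (λ s′ → ∑-rowsFor-placements-⊝ a t s₀ (λ row t″ → ∑ (S s′ t″) (λ Z′ → G (row ∷ Z′)))) ⟩
      ∑ (placements a s) (λ s′ → ∑ (placements a t) (λ t′ → ∑ (rowsFor t′ s₀) (λ row → ∑ (S s′ (t′ ⊝ row)) (λ Z′ → G (row ∷ Z′)))))
        ≡⟨ ∑-cong (placements a s) (λ s′ → ∑-cong (placements a t) (λ t′ → sym (∑-S-∷ s₀ s′ t′ G))) ⟩
      ∑ (placements a s) (λ s′ → Ψ (s₀ ∷ s′)) ∎

  mark : List ℕ → List ℕ → ℕ
  mark []      v = 𝕀 (allZero v)
  mark (a ∷ q) v = ∑ (placements a v) (mark q)

  ∑-placements-++ : ∀ a xs ys (F : List ℕ → ℕ) →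
    ∑ (placements a (xs ++ ys)) F ≡ ∑ (placements a xs) (λ v → F (v ++ ys)) + ∑ (placements a ys) (λ v → F (xs ++ v))
  ∑-placements-++ a []       ys F = refl
  ∑-placements-++ a (x ∷ xs) ys F = begin
    ∑ (placements a (x ∷ xs ++ ys)) F
      ≡⟨ ∑-placements-∷ a x (xs ++ ys) F ⟩
    here + ∑ (placements a (xs ++ ys)) (λ v → F (x ∷ v))
      ≡⟨ cong (here +_) (∑-placements-++ a xs ys (λ v → F (x ∷ v))) ⟩
    here + (∑ (placements a xs) (λ v → F (x ∷ v ++ ys)) + ∑ (placements a ys) (λ v → F (x ∷ xs ++ v)))
      ≡⟨ sym (+-assoc here _ _) ⟩
    here + ∑ (placements a xs) (λ v → F (x ∷ v ++ ys)) + ∑ (placements a ys) (λ v → F (x ∷ xs ++ v))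
      ≡⟨ cong (_+ ∑ (placements a ys) (λ v → F (x ∷ xs ++ v))) (sym (∑-placements-∷ a x xs (λ v → F (v ++ ys)))) ⟩
    ∑ (placements a (x ∷ xs)) (λ v → F (v ++ ys)) + ∑ (placements a ys) (λ v → F (x ∷ xs ++ v)) ∎
    where
    open ≡-Reasoning
    here : ℕ
    here = [ a ≤ x ] * F ((x ∸ a) ∷ xs ++ ys)

  ∑-placements-concat : ∀ a Z (F : List ℕ → ℕ) → ∑ (placements a (concat Z)) F ≡ ∑ (placementsM a Z) (λ Z′ → F (concat Z′))
  ∑-placements-concat a []        F = refl
  ∑-placements-concat a (row ∷ Z) F = begin
    ∑ (placements a (row ++ concat Z)) F
      ≡⟨ ∑-placements-++ a row (concat Z) F ⟩
    ∑ (placements a row) (λ v → F (v ++ concat Z)) + ∑ (placements a (concat Z)) (λ v → F (row ++ v))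
      ≡⟨ cong (∑ (placements a row) (λ v → F (v ++ concat Z)) +_) (∑-placements-concat a Z (λ v → F (row ++ v))) ⟩
    ∑ (placements a row) (λ v → F (v ++ concat Z)) + ∑ (placementsM a Z) (λ Z′ → F (row ++ concat Z′))
      ≡⟨ sym (∑-placementsM-∷ a row Z (λ Z′ → F (concat Z′))) ⟩
    ∑ (placementsM a (row ∷ Z)) (λ Z′ → F (concat Z′)) ∎
    where open ≡-Reasoning

  𝕀-allZero-++ : ∀ xs ys → 𝕀 (allZero (xs ++ ys)) ≡ 𝕀 (allZero xs) * 𝕀 (allZero ys)
  𝕀-allZero-++ []          ys = sym (+-identityʳ _)
  𝕀-allZero-++ (zero ∷ xs) ys = 𝕀-allZero-++ xs ys
  𝕀-allZero-++ (suc _ ∷ _) ys = refl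

  ∑-rowsFor-allZero : ∀ t s → ∑ (rowsFor t s) (λ row → 𝕀 (allZero row) * 𝕀 (allZero (t ⊝ row))) ≡ 𝕀 (allZero (s ∷ [])) * 𝕀 (allZero t)
  ∑-rowsFor-allZero []       zero    = refl
  ∑-rowsFor-allZero []       (suc s) = refl
  ∑-rowsFor-allZero (b ∷ bs) s = begin
    ∑ (rowsFor (b ∷ bs) s) (λ row → 𝕀 (allZero row) * 𝕀 (allZero ((b ∷ bs) ⊝ row)))
      ≡⟨ ∑-rowsFor-∷ b bs s (λ row → 𝕀 (allZero row) * 𝕀 (allZero ((b ∷ bs) ⊝ row))) ⟩
    F 0 + ∑< b (λ i → F (suc i))
      ≡⟨ cong₂ _+_ (*-identityˡ (∑ (rowsFor bs s) (λ row → 𝕀 (allZero row) * 𝕀 (allZero (b ∷ bs ⊝ row)))))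
                   (∑<-zero b (λ i _ → trans (cong ([ suc i ≤ s ] *_) (∑-zero (rowsFor bs (s ∸ suc i)))) (*-zeroʳ ([ suc i ≤ s ])))) ⟩
    ∑ (rowsFor bs s) (λ row → 𝕀 (allZero row) * 𝕀 (allZero (b ∷ bs ⊝ row))) + 0
      ≡⟨ trans (+-identityʳ _) (zero-first-entry b) ⟩
    𝕀 (allZero (s ∷ [])) * 𝕀 (allZero (b ∷ bs)) ∎
    where
    open ≡-Reasoning
    F : ℕ → ℕ
    F z = [ z ≤ s ] * ∑ (rowsFor bs (s ∸ z)) (λ row → 𝕀 (allZero (z ∷ row)) * 𝕀 (allZero ((b ∸ z) ∷ bs ⊝ row)))
    zero-first-entry : ∀ b → ∑ (rowsFor bs s) (λ row → 𝕀 (allZero row) * 𝕀 (allZero (b ∷ bs ⊝ row)))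
                           ≡ 𝕀 (allZero (s ∷ [])) * 𝕀 (allZero (b ∷ bs))
    zero-first-entry zero    = ∑-rowsFor-allZero bs s
    zero-first-entry (suc b) = trans (∑-cong (rowsFor bs s) (λ row → *-zeroʳ (𝕀 (allZero row))))
                                     (trans (∑-zero (rowsFor bs s)) (sym (*-zeroʳ (𝕀 (allZero (s ∷ []))))))

  mark-[]-multiplicative : ∀ s t → ∑ (S s t) (λ Z → mark [] (concat Z)) ≡ mark [] s * mark [] t
  mark-[]-multiplicative [] t with allZero t
  ... | true  = refl
  ... | false = refl
  mark-[]-multiplicative (s₀ ∷ s) t = begin
    ∑ (S (s₀ ∷ s) t) (λ Z → 𝕀 (allZero (concat Z)))
      ≡⟨ ∑-S-∷ s₀ s t (λ Z → 𝕀 (allZero (concat Z))) ⟩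
    ∑ (rowsFor t s₀) (λ row → ∑ (S s (t ⊝ row)) (λ Z → 𝕀 (allZero (row ++ concat Z))))
      ≡⟨ ∑-cong (rowsFor t s₀) (λ row → trans (∑-cong (S s (t ⊝ row)) (λ Z → 𝕀-allZero-++ row (concat Z)))
                                       (trans (∑-distribˡ-* (S s (t ⊝ row)) (𝕀 (allZero row)) (λ Z → 𝕀 (allZero (concat Z))))
                                              (cong (𝕀 (allZero row) *_) (mark-[]-multiplicative s (t ⊝ row))))) ⟩
    ∑ (rowsFor t s₀) (λ row → 𝕀 (allZero row) * (𝕀 (allZero s) * 𝕀 (allZero (t ⊝ row))))
      ≡⟨ ∑-cong (rowsFor t s₀) (λ row → x∙yz≈y∙xz (𝕀 (allZero row)) (𝕀 (allZero s)) _) ⟩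
    ∑ (rowsFor t s₀) (λ row → 𝕀 (allZero s) * (𝕀 (allZero row) * 𝕀 (allZero (t ⊝ row))))
      ≡⟨ ∑-distribˡ-* (rowsFor t s₀) (𝕀 (allZero s)) _ ⟩
    𝕀 (allZero s) * ∑ (rowsFor t s₀) (λ row → 𝕀 (allZero row) * 𝕀 (allZero (t ⊝ row)))
      ≡⟨ cong (𝕀 (allZero s) *_) (∑-rowsFor-allZero t s₀) ⟩
    𝕀 (allZero s) * (𝕀 (allZero (s₀ ∷ [])) * 𝕀 (allZero t))
      ≡⟨ sym (*-assoc (𝕀 (allZero s)) _ _) ⟩
    𝕀 (allZero s) * 𝕀 (allZero (s₀ ∷ [])) * 𝕀 (allZero t)
      ≡⟨ cong (_* 𝕀 (allZero t)) (trans (*-comm (𝕀 (allZero s)) _) (sym (𝕀-allZero-++ (s₀ ∷ []) s))) ⟩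
    𝕀 (allZero (s₀ ∷ s)) * 𝕀 (allZero t) ∎
    where open ≡-Reasoning

  mark-multiplicative : ∀ q s t → ∑ (S s t) (λ Z → mark q (concat Z)) ≡ mark q s * mark q t
  mark-multiplicative []      s t = mark-[]-multiplicative s t
  mark-multiplicative (a ∷ q) s t = begin
    ∑ (S s t) (λ Z → ∑ (placements a (concat Z)) (mark q))
      ≡⟨ ∑-cong (S s t) (λ Z → ∑-placements-concat a Z (mark q)) ⟩
    ∑ (S s t) (λ Z → ∑ (placementsM a Z) (λ Z′ → mark q (concat Z′)))
      ≡⟨ ∑-S-placementsM a s t (λ Z′ → mark q (concat Z′)) ⟩
    ∑ (placements a s) (λ s′ → ∑ (placements a t) (λ t′ → ∑ (S s′ t′) (λ Z′ → mark q (concat Z′))))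
      ≡⟨ ∑-cong (placements a s) (λ s′ → trans (∑-cong (placements a t) (λ t′ → mark-multiplicative q s′ t′))
                                               (∑-distribˡ-* (placements a t) (mark q s′) (mark q))) ⟩
    ∑ (placements a s) (λ s′ → mark q s′ * mark (a ∷ q) t)
      ≡⟨ ∑-distribʳ-* (placements a s) (mark (a ∷ q) t) (mark q) ⟩
    mark (a ∷ q) s * mark (a ∷ q) t ∎
    where open ≡-Reasoning

  -- Compositions, refinements and triangularity

  Positive : List ℕ → Set
  Positive = All (0 <_)

  IsComposition : ℕ → List ℕ → Set
  IsComposition n w = Positive w × sum w ≡ n

  all-concatMap : ∀ {a b p q} {A : Set a} {B : Set b} {P : B → Set p} {Q : A → Set q} {f : A → List B} {xs} →
                  All Q xs → (∀ x → Q x → All P (f x)) → All P (concatMap f xs)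
  all-concatMap qxs h = Allₚ.concat⁺ (Allₚ.map⁺ (All.map (λ {x} → h x) qxs))

  range-bounds : ∀ lo hi → All (λ k → lo ≤ k × k ≤ hi) (range lo hi)
  range-bounds lo hi = Allₚ.map⁺ (All.map (λ {i} i< → m≤m+n lo i , bound i i<) (Allₚ.all-upTo (suc hi ∸ lo)))
    where
    bound : ∀ i → i < suc hi ∸ lo → lo + i ≤ hi
    bound i i< with lo ≤? hi
    ... | yes lo≤hi = subst (_≤ hi) (+-comm i lo) (m≤o∸n⇒m+n≤o i lo≤hi (≤-pred (subst (suc i ≤_) (+-∸-assoc 1 lo≤hi) i<)))
    ... | no  lo≰hi = contradiction (subst (i <_) (m≤n⇒m∸n≡0 (≰⇒> lo≰hi)) i<) λ ()

  rowsFor-sum : ∀ r a → All (λ row → sum row ≡ a) (rowsFor r a)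
  rowsFor-sum []       zero    = refl ∷ []
  rowsFor-sum []       (suc a) = []
  rowsFor-sum (b ∷ bs) a = Allₚ.concat⁺ (Allₚ.map⁺ (All.universal (λ z → from z (z ≤? a)) (range 0 b)))
    where
    from : ∀ z (z≤?a : Dec (z ≤ a)) → All (λ row → sum row ≡ a) (if does z≤?a then map (z ∷_) (rowsFor bs (a ∸ z)) else [])
    from z (yes z≤a) = Allₚ.map⁺ (All.map (λ e → trans (cong (z +_) e) (m+[n∸m]≡n z≤a)) (rowsFor-sum bs (a ∸ z)))
    from z (no _)    = []

  compsF-compositions : ∀ f m → All (IsComposition m) (compsF f m)
  compsF-compositions f       zero    = ([] , refl) ∷ []
  compsF-compositions zero    (suc m) = []
  compsF-compositions (suc f) (suc m) = all-concatMap (range-bounds 1 (suc m)) λ k (1≤k , k≤m) →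
    Allₚ.map⁺ (All.map (λ (pos , total) → (1≤k ∷ pos) , trans (cong (k +_) total) (m+[n∸m]≡n k≤m))
                      (compsF-compositions f (suc m ∸ k)))

  dropZeros-++ : ∀ xs ys → dropZeros (xs ++ ys) ≡ dropZeros xs ++ dropZeros ys
  dropZeros-++ []           ys = refl
  dropZeros-++ (zero ∷ xs)  ys = dropZeros-++ xs ys
  dropZeros-++ (suc x ∷ xs) ys = cong (suc x ∷_) (dropZeros-++ xs ys)

  sum-dropZeros : ∀ xs → sum (dropZeros xs) ≡ sum xs
  sum-dropZeros []           = refl
  sum-dropZeros (zero ∷ xs)  = sum-dropZeros xs
  sum-dropZeros (suc x ∷ xs) = cong (suc x +_) (sum-dropZeros xs)

  dropZeros-positive : ∀ xs → Positive (dropZeros xs)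
  dropZeros-positive []           = []
  dropZeros-positive (zero ∷ xs)  = dropZeros-positive xs
  dropZeros-positive (suc x ∷ xs) = s≤s z≤n ∷ dropZeros-positive xs

  c-∷ : ∀ row Z → c (row ∷ Z) ≡ dropZeros row ++ c Z
  c-∷ row Z = dropZeros-++ row (concat Z)

  data Refines : List ℕ → List ℕ → Set where
    []  : Refines [] []
    _∷_ : ∀ {d D w a q} → d + sum D ≡ a → Refines w q → Refines (d ∷ D ++ w) (a ∷ q)

  refines-sum : ∀ {w q} → Refines w q → sum w ≡ sum q
  refines-sum []                         = refl
  refines-sum (_∷_ {d} {D} {w} {a} {q} d+D≡a ρ) = begin
    d + sum (D ++ w)     ≡⟨ cong (d +_) (sum-++ D w) ⟩
    d + (sum D + sum w)  ≡⟨ sym (+-assoc d (sum D) (sum w)) ⟩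
    d + sum D + sum w    ≡⟨ cong₂ _+_ d+D≡a (refines-sum ρ) ⟩
    a + sum q            ∎
    where open ≡-Reasoning

  length<length-∷-++ : ∀ (x : ℕ) D w → length w < length (x ∷ D ++ w)
  length<length-∷-++ x D w = s≤s (≤-trans (m≤n+m (length w) (length D)) (≤-reflexive (sym (length-++ D))))

  refines-length : ∀ {w q} → Refines w q → length q ≤ length w
  refines-length []                      = z≤n
  refines-length (_∷_ {d} {D} {w} _ ρ) = ≤-trans (s≤s (refines-length ρ)) (length<length-∷-++ d D w)

  refines-∷-injective : ∀ {d D w a q} → Refines w q → d ∷ D ++ w ≡ a ∷ q → D ≡ [] × d ≡ a × w ≡ q
  refines-∷-injective {D = []}    ρ e = refl , ∷-injectiveˡ e , ∷-injectiveʳ e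
  refines-∷-injective {D = x ∷ D} {w} ρ e =
    contradiction (refines-length ρ) (<⇒≱ (subst (length w <_) (cong length (∷-injectiveʳ e)) (length<length-∷-++ x D w)))

  refines-length-≡ : ∀ {w q} → Refines w q → length w ≡ length q → w ≡ q
  refines-length-≡ [] _ = refl
  refines-length-≡ {q = a ∷ q} (_∷_ {d} {D} {w} d+D≡a ρ) len≡ with D
  ... | []     = cong₂ _∷_ (trans (sym (+-identityʳ d)) d+D≡a) (refines-length-≡ ρ (suc-injective len≡))
  ... | x ∷ D′ =
    contradiction (refines-length ρ) (<⇒≱ (subst (length w <_) (suc-injective len≡) (length<length-∷-++ x D′ w)))

  c-refines : ∀ q r → Positive q → All (λ Z → Refines (c Z) q) (S q r)
  c-refines []      r _ with allZero r
  ... | true  = [] ∷ []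
  ... | false = []
  c-refines (a ∷ q) r (0<a ∷ pos) = all-concatMap (rowsFor-sum r a) λ row row-sum →
    Allₚ.map⁺ (All.map (λ {Z} ρ → subst (λ w → Refines w (a ∷ q)) (sym (c-∷ row Z)) (head row row-sum ρ))
                      (c-refines q (r ⊝ row) pos))
    where
    head : ∀ row → sum row ≡ a → ∀ {w} → Refines w q → Refines (dropZeros row ++ w) (a ∷ q)
    head row row-sum ρ with dropZeros row | sum-dropZeros row
    ... | []    | sum≡ = contradiction (trans sum≡ row-sum) (λ 0≡a → <⇒≢ 0<a 0≡a)
    ... | d ∷ D | sum≡ = trans sum≡ row-sum ∷ ρ

  δ-c-∷ : ∀ row Z a q → 0 < a → sum row ≡ a → Refines (c Z) q →
          δ (c (row ∷ Z)) (a ∷ q) ≡ δ (dropZeros row) (a ∷ []) * δ (c Z) q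
  δ-c-∷ row Z a q 0<a row-sum ρ =
    𝕀-× (c (row ∷ Z) ≟ₗ a ∷ q) (dropZeros row ≟ₗ a ∷ []) (c Z ≟ₗ q)
        (λ e → split (trans (sym (c-∷ row Z)) e))
        (λ (e₁ , e₂) → trans (c-∷ row Z) (cong₂ _++_ e₁ e₂))
    where
    split : dropZeros row ++ c Z ≡ a ∷ q → dropZeros row ≡ a ∷ [] × c Z ≡ q
    split e with dropZeros row | sum-dropZeros row
    ... | []    | 0≡sum = contradiction (trans 0≡sum row-sum) (<⇒≢ 0<a)
    ... | d ∷ D | _     with refines-∷-injective ρ e
    ...   | D≡[] , d≡a , cZ≡q = cong₂ _∷_ d≡a D≡[] , cZ≡q

  ∑-rowsFor-0 : ∀ r (G : List ℕ → ℕ) → ∑ (rowsFor r 0) (λ row → δ (dropZeros row) [] * G (r ⊝ row)) ≡ G r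
  ∑-rowsFor-0 []       G = trans (+-identityʳ (1 * G [])) (*-identityˡ (G []))
  ∑-rowsFor-0 (b ∷ bs) G = begin
    ∑ (rowsFor (b ∷ bs) 0) (λ row → δ (dropZeros row) [] * G ((b ∷ bs) ⊝ row))
      ≡⟨ ∑-rowsFor-∷ b bs 0 (λ row → δ (dropZeros row) [] * G ((b ∷ bs) ⊝ row)) ⟩
    1 * ∑ (rowsFor bs 0) (λ row → δ (dropZeros row) [] * G (b ∷ bs ⊝ row)) + ∑< b (λ _ → 0)
      ≡⟨ cong₂ _+_ (*-identityˡ _) (∑<-zero b (λ _ _ → refl)) ⟩
    ∑ (rowsFor bs 0) (λ row → δ (dropZeros row) [] * G (b ∷ bs ⊝ row)) + 0
      ≡⟨ trans (+-identityʳ _) (∑-rowsFor-0 bs (λ u → G (b ∷ u))) ⟩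
    G (b ∷ bs) ∎
    where open ≡-Reasoning

  ∑-rowsFor-single : ∀ a r (F : List ℕ → ℕ) → 0 < a →
    ∑ (rowsFor r a) (λ row → δ (dropZeros row) (a ∷ []) * F (r ⊝ row)) ≡ ∑ (placements a r) F
  ∑-rowsFor-single zero    r        F ()
  ∑-rowsFor-single (suc a) []       F _ = refl
  ∑-rowsFor-single (suc a) (b ∷ bs) F _ = begin
    ∑ (rowsFor (b ∷ bs) (suc a)) (λ row → δ (dropZeros row) (suc a ∷ []) * F ((b ∷ bs) ⊝ row))
      ≡⟨ ∑-rowsFor-∷ b bs (suc a) (λ row → δ (dropZeros row) (suc a ∷ []) * F ((b ∷ bs) ⊝ row)) ⟩
    entry 0 + ∑< b (λ i → entry (suc i))
      ≡⟨ cong₂ _+_ (trans (*-identityˡ _) (∑-rowsFor-single (suc a) bs (λ u → F (b ∷ u)) (s≤s z≤n))) nonzero-entries ⟩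
    ∑ (placements (suc a) bs) (λ v → F (b ∷ v)) + [ suc a ≤ b ] * F ((b ∸ suc a) ∷ bs)
      ≡⟨ trans (+-comm (∑ (placements (suc a) bs) (λ v → F (b ∷ v))) _) (sym (∑-placements-∷ (suc a) b bs F)) ⟩
    ∑ (placements (suc a) (b ∷ bs)) F ∎
    where
    open ≡-Reasoning
    entry : ℕ → ℕ
    entry z = [ z ≤ suc a ] * ∑ (rowsFor bs (suc a ∸ z)) (λ row → δ (dropZeros (z ∷ row)) (suc a ∷ []) * F ((b ∸ z) ∷ bs ⊝ row))
    other-entry : ∀ i → i ≢ a → entry (suc i) ≡ 0
    other-entry i i≢a = trans (cong ([ suc i ≤ suc a ] *_)
      (trans (∑-cong (rowsFor bs (a ∸ i)) (λ row → cong (_* F ((b ∸ suc i) ∷ bs ⊝ row))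
                (𝕀-no (suc i ∷ dropZeros row ≟ₗ suc a ∷ []) (λ e → i≢a (suc-injective (∷-injectiveˡ e))))))
             (∑-zero (rowsFor bs (a ∸ i))))) (*-zeroʳ ([ suc i ≤ suc a ]))
    whole-entry : entry (suc a) ≡ F ((b ∸ suc a) ∷ bs)
    whole-entry = begin
      entry (suc a)
        ≡⟨ cong (_* ∑ (rowsFor bs (a ∸ a)) (λ row → δ (suc a ∷ dropZeros row) (suc a ∷ []) * F ((b ∸ suc a) ∷ bs ⊝ row)))
                (𝕀-yes (suc a ≤? suc a) ≤-refl) ⟩
      1 * ∑ (rowsFor bs (a ∸ a)) (λ row → δ (suc a ∷ dropZeros row) (suc a ∷ []) * F ((b ∸ suc a) ∷ bs ⊝ row))
        ≡⟨ *-identityˡ _ ⟩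
      ∑ (rowsFor bs (a ∸ a)) (λ row → δ (suc a ∷ dropZeros row) (suc a ∷ []) * F ((b ∸ suc a) ∷ bs ⊝ row))
        ≡⟨ cong (λ k → ∑ (rowsFor bs k) (λ row → δ (suc a ∷ dropZeros row) (suc a ∷ []) * F ((b ∸ suc a) ∷ bs ⊝ row))) (n∸n≡0 a) ⟩
      ∑ (rowsFor bs 0) (λ row → δ (suc a ∷ dropZeros row) (suc a ∷ []) * F ((b ∸ suc a) ∷ bs ⊝ row))
        ≡⟨ ∑-cong (rowsFor bs 0) (λ row → cong (_* F ((b ∸ suc a) ∷ bs ⊝ row)) (δ-∷ (suc a) (dropZeros row) [])) ⟩
      ∑ (rowsFor bs 0) (λ row → δ (dropZeros row) [] * F ((b ∸ suc a) ∷ bs ⊝ row))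
        ≡⟨ ∑-rowsFor-0 bs (λ u → F ((b ∸ suc a) ∷ u)) ⟩
      F ((b ∸ suc a) ∷ bs) ∎
    nonzero-entries : ∑< b (λ i → entry (suc i)) ≡ [ suc a ≤ b ] * F ((b ∸ suc a) ∷ bs)
    nonzero-entries with suc a ≤? b
    ... | yes a<b = trans (∑<-single b a (λ i → entry (suc i)) a<b (λ i _ → other-entry i))
                          (trans whole-entry (sym (trans (cong (_* F ((b ∸ suc a) ∷ bs)) (𝕀-yes (suc a ≤? b) a<b))
                                                         (*-identityˡ (F ((b ∸ suc a) ∷ bs))))))
    ... | no  a≮b = trans (∑<-zero b {λ i → entry (suc i)} (λ i i<b → other-entry i (λ i≡a → a≮b (subst (_< b) i≡a i<b))))
                          (sym (cong (_* F ((b ∸ suc a) ∷ bs)) (𝕀-no (suc a ≤? b) a≮b)))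

  ∑-S-δ-c : ∀ q r → Positive q → ∑ (S q r) (λ Z → δ (c Z) q) ≡ mark q r
  ∑-S-δ-c []      r _ with allZero r
  ... | true  = refl
  ... | false = refl
  ∑-S-δ-c (a ∷ q) r (0<a ∷ pos) = begin
    ∑ (S (a ∷ q) r) (λ Z → δ (c Z) (a ∷ q))
      ≡⟨ ∑-S-∷ a q r (λ Z → δ (c Z) (a ∷ q)) ⟩
    ∑ (rowsFor r a) (λ row → ∑ (S q (r ⊝ row)) (λ Z → δ (c (row ∷ Z)) (a ∷ q)))
      ≡⟨ ∑-cong-All (rowsFor-sum r a) (λ row row-sum → begin
           ∑ (S q (r ⊝ row)) (λ Z → δ (c (row ∷ Z)) (a ∷ q))
             ≡⟨ ∑-cong-All (c-refines q (r ⊝ row) pos) (λ Z ρ → δ-c-∷ row Z a q 0<a row-sum ρ) ⟩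
           ∑ (S q (r ⊝ row)) (λ Z → δ (dropZeros row) (a ∷ []) * δ (c Z) q)
             ≡⟨ ∑-distribˡ-* (S q (r ⊝ row)) (δ (dropZeros row) (a ∷ [])) (λ Z → δ (c Z) q) ⟩
           δ (dropZeros row) (a ∷ []) * ∑ (S q (r ⊝ row)) (λ Z → δ (c Z) q)
             ≡⟨ cong (δ (dropZeros row) (a ∷ []) *_) (∑-S-δ-c q (r ⊝ row) pos) ⟩
           δ (dropZeros row) (a ∷ []) * mark q (r ⊝ row) ∎) ⟩
    ∑ (rowsFor r a) (λ row → δ (dropZeros row) (a ∷ []) * mark q (r ⊝ row))
      ≡⟨ ∑-rowsFor-single a r (mark q) 0<a ⟩
    mark (a ∷ q) r ∎
    where open ≡-Reasoning

  count-triangular : ∀ q r w → Positive q → length w ≤ length q → count q r w ≡ δ q w * mark q r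
  count-triangular q r w pos w≤q = trans (count-∑ q r w) (by-cases (q ≟ₗ w))
    where
    by-cases : (q≟w : Dec (q ≡ w)) → ∑ (S q r) (λ Z → δ (c Z) w) ≡ 𝕀 (does q≟w) * mark q r
    by-cases (yes refl) = trans (∑-S-δ-c q r pos) (sym (+-identityʳ _))
    by-cases (no q≢w)   = trans (∑-cong-All (c-refines q r pos) (λ Z ρ → 𝕀-no (c Z ≟ₗ w) (c≢w Z ρ))) (∑-zero (S q r))
      where
      c≢w : ∀ Z → Refines (c Z) q → c Z ≢ w
      c≢w Z ρ cZ≡w = q≢w (trans (sym (refines-length-≡ ρ same-length)) cZ≡w)
        where
        same-length : length (c Z) ≡ length q
        same-length = ≤-antisym (subst (λ u → length u ≤ length q) (sym cZ≡w) w≤q) (refines-length ρ)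

  allZero-insert-0 : ∀ pre v → allZero (pre ++ 0 ∷ v) ≡ allZero (pre ++ v)
  allZero-insert-0 []            v = refl
  allZero-insert-0 (zero ∷ pre)  v = allZero-insert-0 pre v
  allZero-insert-0 (suc _ ∷ pre) v = refl

  mark-insert-0 : ∀ q → Positive q → ∀ pre v → mark q (pre ++ 0 ∷ v) ≡ mark q (pre ++ v)
  mark-insert-0 []      _           pre v = cong 𝕀 (allZero-insert-0 pre v)
  mark-insert-0 (a ∷ q) (0<a ∷ pos) pre v = begin
    ∑ (placements a (pre ++ 0 ∷ v)) (mark q)
      ≡⟨ ∑-placements-++ a pre (0 ∷ v) (mark q) ⟩
    ∑ (placements a pre) (λ u → mark q (u ++ 0 ∷ v)) + ∑ (placements a (0 ∷ v)) (λ u → mark q (pre ++ u))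
      ≡⟨ cong₂ _+_ (∑-cong (placements a pre) (λ u → mark-insert-0 q pos u v)) placed-after ⟩
    ∑ (placements a pre) (λ u → mark q (u ++ v)) + ∑ (placements a v) (λ u → mark q (pre ++ u))
      ≡⟨ sym (∑-placements-++ a pre v (mark q)) ⟩
    ∑ (placements a (pre ++ v)) (mark q) ∎
    where
    open ≡-Reasoning
    placed-after : ∑ (placements a (0 ∷ v)) (λ u → mark q (pre ++ u)) ≡ ∑ (placements a v) (λ u → mark q (pre ++ u))
    placed-after = begin
      ∑ (placements a (0 ∷ v)) (λ u → mark q (pre ++ u))
        ≡⟨ ∑-placements-∷ a 0 v (λ u → mark q (pre ++ u)) ⟩
      [ a ≤ 0 ] * mark q (pre ++ 0 ∸ a ∷ v) + ∑ (placements a v) (λ u → mark q (pre ++ 0 ∷ u))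
        ≡⟨ cong₂ _+_ (cong (_* mark q (pre ++ 0 ∸ a ∷ v)) (𝕀-no (a ≤? 0) (<⇒≱ 0<a)))
                     (∑-cong (placements a v) (λ u → mark-insert-0 q pos pre u)) ⟩
      ∑ (placements a v) (λ u → mark q (pre ++ u)) ∎

  mark-dropZeros : ∀ q → Positive q → ∀ w → mark q (dropZeros w) ≡ mark q w
  mark-dropZeros q pos w = after [] w
    where
    after : ∀ pre w → mark q (pre ++ dropZeros w) ≡ mark q (pre ++ w)
    after pre []          = refl
    after pre (zero ∷ w)  = trans (after pre w) (sym (mark-insert-0 q pos pre w))
    after pre (suc k ∷ w) = begin
      mark q (pre ++ suc k ∷ dropZeros w)    ≡⟨ cong (mark q) (sym (++-assoc pre (suc k ∷ []) (dropZeros w))) ⟩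
      mark q ((pre ++ suc k ∷ []) ++ dropZeros w) ≡⟨ after (pre ++ suc k ∷ []) w ⟩
      mark q ((pre ++ suc k ∷ []) ++ w)      ≡⟨ cong (mark q) (++-assoc pre (suc k ∷ []) w) ⟩
      mark q (pre ++ suc k ∷ w)              ∎
      where open ≡-Reasoning

  ∑-compsF-∷ : ∀ f m (g : List ℕ → ℕ) →
    ∑ (compsF (suc f) (suc m)) g ≡ ∑< (suc m) (λ i → ∑ (compsF f (m ∸ i)) (λ w → g (suc i ∷ w)))
  ∑-compsF-∷ f m g = begin
    ∑ (compsF (suc f) (suc m)) g
      ≡⟨ ∑-concatMap (λ k → map (k ∷_) (compsF f (suc m ∸ k))) (range 1 (suc m)) g ⟩
    ∑ (range 1 (suc m)) (λ k → ∑ (map (k ∷_) (compsF f (suc m ∸ k))) g)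
      ≡⟨ ∑-map (1 +_) (upTo (suc m)) (λ k → ∑ (map (k ∷_) (compsF f (suc m ∸ k))) g) ⟩
    ∑ (upTo (suc m)) (λ i → ∑ (map (suc i ∷_) (compsF f (m ∸ i))) g)
      ≡⟨ ∑-applyUpTo (λ i → i) (suc m) (λ i → ∑ (map (suc i ∷_) (compsF f (m ∸ i))) g) ⟩
    ∑< (suc m) (λ i → ∑ (map (suc i ∷_) (compsF f (m ∸ i))) g)
      ≡⟨ ∑<-cong (suc m) (λ i _ → ∑-map (suc i ∷_) (compsF f (m ∸ i)) g) ⟩
    ∑< (suc m) (λ i → ∑ (compsF f (m ∸ i)) (λ w → g (suc i ∷ w))) ∎
    where open ≡-Reasoning

  ∑-compsF-δ : ∀ f m v → IsComposition m v → m ≤ f → ∑ (compsF f m) (δ v) ≡ 1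
  ∑-compsF-δ f       zero    []      _                    _ = refl
  ∑-compsF-δ f       zero    (k ∷ v) (0<k ∷ _ , k+v≡0)    _ = contradiction (m+n≡0⇒m≡0 k k+v≡0) (<⇒≢ 0<k ∘ sym)
  ∑-compsF-δ zero    (suc m) v       _                    ()
  ∑-compsF-δ (suc f) (suc m) []      (_ , ())             _
  ∑-compsF-δ (suc f) (suc m) (suc i₀ ∷ v) (_ ∷ pos , total) (s≤s m≤f) = begin
    ∑ (compsF (suc f) (suc m)) (δ (suc i₀ ∷ v))
      ≡⟨ ∑-compsF-∷ f m (δ (suc i₀ ∷ v)) ⟩
    ∑< (suc m) (λ i → ∑ (compsF f (m ∸ i)) (λ w → δ (suc i₀ ∷ v) (suc i ∷ w)))
      ≡⟨ ∑<-single (suc m) i₀ _ i₀<1+m (λ i _ → other-head i) ⟩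
    ∑ (compsF f (m ∸ i₀)) (λ w → δ (suc i₀ ∷ v) (suc i₀ ∷ w))
      ≡⟨ ∑-cong (compsF f (m ∸ i₀)) (δ-∷ (suc i₀) v) ⟩
    ∑ (compsF f (m ∸ i₀)) (δ v)
      ≡⟨ ∑-compsF-δ f (m ∸ i₀) v (pos , rest) (≤-trans (m∸n≤m m i₀) m≤f) ⟩
    1 ∎
    where
    open ≡-Reasoning
    i₀+v≡m : i₀ + sum v ≡ m
    i₀+v≡m = suc-injective total
    i₀<1+m : i₀ < suc m
    i₀<1+m = s≤s (subst (i₀ ≤_) i₀+v≡m (m≤m+n i₀ (sum v)))
    rest : sum v ≡ m ∸ i₀
    rest = sym (trans (cong (_∸ i₀) (sym i₀+v≡m)) (m+n∸m≡n i₀ (sum v)))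
    other-head : ∀ i → i ≢ i₀ → ∑ (compsF f (m ∸ i)) (λ w → δ (suc i₀ ∷ v) (suc i ∷ w)) ≡ 0
    other-head i i≢i₀ = trans (∑-cong (compsF f (m ∸ i)) (λ w → 𝕀-no (suc i₀ ∷ v ≟ₗ suc i ∷ w)
                                  (λ e → i≢i₀ (sym (suc-injective (∷-injectiveˡ e))))))
                              (∑-zero (compsF f (m ∸ i)))

  ∑-comps-sift : ∀ n v (g : List ℕ → ℕ) → IsComposition n v → ∑ (comps n) (λ w → δ v w * g w) ≡ g v
  ∑-comps-sift n v g v∈ = begin
    ∑ (comps n) (λ w → δ v w * g w)  ≡⟨ ∑-cong (comps n) (λ w → δ-*-subst v w g) ⟩
    ∑ (comps n) (λ w → δ v w * g v)  ≡⟨ ∑-distribʳ-* (comps n) (g v) (δ v) ⟩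
    ∑ (comps n) (δ v) * g v          ≡⟨ cong (_* g v) (∑-compsF-δ n n v v∈ ≤-refl) ⟩
    1 * g v                          ≡⟨ *-identityˡ (g v) ⟩
    g v                              ∎
    where open ≡-Reasoning

  ∑-count-mark : ∀ n q s t → Positive q → sum s ≡ n → Positive s →
    ∑ (comps n) (λ w → count s t w * mark q w) ≡ mark q s * mark q t
  ∑-count-mark n q s t pos-q s-sum pos-s = begin
    ∑ (comps n) (λ w → count s t w * mark q w)
      ≡⟨ ∑-cong (comps n) (λ w → trans (cong (_* mark q w) (count-∑ s t w)) (sym (∑-distribʳ-* (S s t) (mark q w) (λ Z → δ (c Z) w)))) ⟩
    ∑ (comps n) (λ w → ∑ (S s t) (λ Z → δ (c Z) w * mark q w))
      ≡⟨ ∑-comm (comps n) (S s t) (λ w Z → δ (c Z) w * mark q w) ⟩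
    ∑ (S s t) (λ Z → ∑ (comps n) (λ w → δ (c Z) w * mark q w))
      ≡⟨ ∑-cong-All (c-refines s t pos-s) (λ Z ρ →
           trans (∑-comps-sift n (c Z) (mark q) (dropZeros-positive (concat Z) , trans (refines-sum ρ) s-sum))
                 (mark-dropZeros q pos-q (concat Z))) ⟩
    ∑ (S s t) (λ Z → mark q (concat Z))
      ≡⟨ mark-multiplicative q s t ⟩
    mark q s * mark q t ∎
    where open ≡-Reasoning

  ∑-rowsFor-singleton : ∀ m a (G : List ℕ → ℕ) → a ≤ m → ∑ (rowsFor (m ∷ []) a) G ≡ G (a ∷ [])
  ∑-rowsFor-singleton m a G a≤m = begin
    ∑ (rowsFor (m ∷ []) a) G
      ≡⟨ ∑-rowsFor-∷ m [] a G ⟩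
    ∑< (suc m) entry
      ≡⟨ ∑<-single (suc m) a entry (s≤s a≤m) (λ z _ → other-entry z) ⟩
    entry a
      ≡⟨ cong₂ _*_ (𝕀-yes (a ≤? a) ≤-refl) (cong (λ k → ∑ (rowsFor [] k) (λ row → G (a ∷ row))) (n∸n≡0 a)) ⟩
    1 * (G (a ∷ []) + 0)
      ≡⟨ trans (*-identityˡ _) (+-identityʳ _) ⟩
    G (a ∷ []) ∎
    where
    open ≡-Reasoning
    leftover : ℕ → ℕ
    leftover z = ∑ (rowsFor [] (a ∸ z)) (λ row → G (z ∷ row))
    entry : ℕ → ℕ
    entry z = [ z ≤ a ] * leftover z
    no-rows : ∀ z → a ∸ z ≢ 0 → leftover z ≡ 0
    no-rows z a∸z≢0 with a ∸ z
    ... | zero  = contradiction refl a∸z≢0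
    ... | suc _ = refl
    other-entry : ∀ z → z ≢ a → entry z ≡ 0
    other-entry z z≢a with z ≤? a
    ... | yes z≤a = trans (cong ([ z ≤ a ] *_) (no-rows z (m>n⇒m∸n≢0 (≤∧≢⇒< z≤a z≢a))))
                          (*-zeroʳ ([ z ≤ a ]))
    ... | no  z≰a = cong (_* leftover z) (𝕀-no (z ≤? a) z≰a)

  ∑-S-column : ∀ q m (f : List (List ℕ) → ℕ) → sum q ≡ m → ∑ (S q (m ∷ [])) f ≡ f (map (_∷ []) q)
  ∑-S-column []      .0 f refl = +-identityʳ (f [])
  ∑-S-column (a ∷ q) m  f q-sum = begin
    ∑ (S (a ∷ q) (m ∷ [])) f
      ≡⟨ ∑-S-∷ a q (m ∷ []) f ⟩
    ∑ (rowsFor (m ∷ []) a) (λ row → ∑ (S q ((m ∷ []) ⊝ row)) (λ Z → f (row ∷ Z)))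
      ≡⟨ ∑-rowsFor-singleton m a _ (subst (a ≤_) q-sum (m≤m+n a (sum q))) ⟩
    ∑ (S q ((m ∸ a) ∷ [])) (λ Z → f ((a ∷ []) ∷ Z))
      ≡⟨ ∑-S-column q (m ∸ a) (λ Z → f ((a ∷ []) ∷ Z)) (sym (trans (cong (_∸ a) (sym q-sum)) (m+n∸m≡n a (sum q)))) ⟩
    f (map (_∷ []) (a ∷ q)) ∎
    where open ≡-Reasoning

  c-column : ∀ q → Positive q → c (map (_∷ []) q) ≡ q
  c-column []          _           = refl
  c-column (suc a ∷ q) (_ ∷ pos)  = cong (suc a ∷_) (c-column q pos)

  count-column : ∀ q w → Positive q → count q (sum q ∷ []) w ≡ δ q w
  count-column q w pos = begin
    count q (sum q ∷ []) w                             ≡⟨ count-∑ q (sum q ∷ []) w ⟩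
    ∑ (S q (sum q ∷ [])) (λ Z → δ (c Z) w)             ≡⟨ ∑-S-column q (sum q) (λ Z → δ (c Z) w) refl ⟩
    δ (c (map (_∷ []) q)) w                            ≡⟨ cong (λ u → δ u w) (c-column q pos) ⟩
    δ q w                                              ∎
    where open ≡-Reasoning

  length≤sum : ∀ w → Positive w → length w ≤ sum w
  length≤sum []      _           = z≤n
  length≤sum (k ∷ w) (0<k ∷ pos) = +-mono-≤ 0<k (length≤sum w pos)

module IntegerSums where

  open import Data.Integer using (ℤ; +_; _+_; _-_)
  import Data.Integer.Properties as ℤₚ
  open import Data.Integer.Tactic.RingSolver using (solve-∀)
  import Data.Nat.Properties as ℕₚ
  open import Relation.Binary.PropositionalEquality

  open ListSum ℤₚ.+-*-commutativeSemiring public using () renaming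
    (∑ to ∑ℤ; ∑-cong to ∑ℤ-cong; ∑-cong-All to ∑ℤ-cong-All; ∑-zero to ∑ℤ-zero; ∑-distrib-+ to ∑ℤ-distrib-+;
     ∑-distribˡ-* to ∑ℤ-distribˡ-*; ∑-distribʳ-* to ∑ℤ-distribʳ-*; ∑-comm to ∑ℤ-comm)
  open ListSum ℕₚ.+-*-commutativeSemiring using (∑)

  ∑ℤ-distrib-- : ∀ {a} {A : Set a} xs (f g : A → ℤ) → ∑ℤ xs (λ x → f x - g x) ≡ ∑ℤ xs f - ∑ℤ xs g
  ∑ℤ-distrib-- []       f g = refl
  ∑ℤ-distrib-- (x ∷ xs) f g = trans (cong (_+_ (f x - g x)) (∑ℤ-distrib-- xs f g)) (interchange (f x) (g x) _ _)
    where
    interchange : ∀ a b c d → (a - b) + (c - d) ≡ (a + c) - (b + d)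
    interchange = solve-∀

  pos-∑ : ∀ {a} {A : Set a} xs (f : A → ℕ) → + (∑ xs f) ≡ ∑ℤ xs (λ x → + f x)
  pos-∑ []       f = refl
  pos-∑ (x ∷ xs) f = trans (ℤₚ.pos-+ (f x) (∑ xs f)) (cong (_+_ (+ f x)) (pos-∑ xs f))

  sumℤ-concatMap-map : ∀ {a b} {A : Set a} {B : Set b} (xs : List A) (ys : List B) (f : A → B → ℤ) →
    sumℤ (concatMap (λ x → map (f x) ys) xs) ≡ ∑ℤ xs (λ x → ∑ℤ ys (f x))
  sumℤ-concatMap-map []       ys f = refl
  sumℤ-concatMap-map (x ∷ xs) ys f = trans (sumℤ-++ (map (f x) ys) _) (cong₂ _+_ (sumℤ-map ys) (sumℤ-concatMap-map xs ys f))
    where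
    sumℤ-++ : ∀ us vs → sumℤ (us ++ vs) ≡ sumℤ us + sumℤ vs
    sumℤ-++ []       vs = sym (ℤₚ.+-identityˡ _)
    sumℤ-++ (u ∷ us) vs = trans (cong (_+_ u) (sumℤ-++ us vs)) (sym (ℤₚ.+-assoc u _ _))
    sumℤ-map : ∀ zs → sumℤ (map (f x) zs) ≡ ∑ℤ zs (f x)
    sumℤ-map []       = refl
    sumℤ-map (z ∷ zs) = cong (_+_ (f x z)) (sumℤ-map zs)

module Descent (n : ℕ) where

  open Marks
  open IntegerSums
  open import Data.Integer using (ℤ; +_; _+_; _*_; _-_)
  import Data.Integer.Properties as ℤₚ
  open import Data.Integer.Tactic.RingSolver using (solve-∀)
  open import Data.List.Membership.Propositional using (_∈_)
  import Data.List.Relation.Unary.All as All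
  open import Data.Nat using (_≤_; _<?_)
  import Data.Nat.Properties as ℕₚ
  open import Data.Nat.ListAction using (sum)
  open import Data.Product using (_,_)
  open import Relation.Binary.PropositionalEquality
  open import Data.Bool using (true; false)
  open import Relation.Nullary using (Dec; yes; no; does)
  open ListSum ℕₚ.+-*-commutativeSemiring using (∑)

  𝟙-δ : ∀ w → 𝟙 n w ≡ + δ w (n ∷ [])
  𝟙-δ w with does (w ≟ₗ n ∷ [])
  ... | true  = refl
  ... | false = refl

  infixl 7 _·_
  infixl 6 _−_

  _·_ : Elem → Elem → Elem
  _·_ = _⋆_ n

  _−_ : Elem → Elem → Elem
  _−_ = _⊖_ n

  C : List (List ℕ)
  C = comps n

  comps-compositions : ∀ {w} → w ∈ C → IsComposition n w
  comps-compositions = All.lookup (compsF-compositions n n)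

  ·-expand : ∀ x y w → (x · y) w ≡ ∑ℤ C (λ q → ∑ℤ C (λ r → x q * y r * + count q r w))
  ·-expand x y w = sumℤ-concatMap-map C C (λ q r → x q * y r * + count q r w)

  ∑ℤ-comps-sift : ∀ v (f : List ℕ → ℤ) → IsComposition n v → ∑ℤ C (λ w → f w * + δ v w) ≡ f v
  ∑ℤ-comps-sift v f v∈ = begin
    ∑ℤ C (λ w → f w * + δ v w)  ≡⟨ ∑ℤ-cong C (λ w → subst-δ w (v ≟ₗ w)) ⟩
    ∑ℤ C (λ w → f v * + δ v w)  ≡⟨ ∑ℤ-distribˡ-* C (f v) (λ w → + δ v w) ⟩
    f v * ∑ℤ C (λ w → + δ v w)  ≡⟨ cong (f v *_) (sym (pos-∑ C (δ v))) ⟩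
    f v * + ∑ C (δ v)           ≡⟨ cong (λ k → f v * + k) (∑-compsF-δ n n v v∈ ℕₚ.≤-refl) ⟩
    f v * + 1                   ≡⟨ ℤₚ.*-identityʳ (f v) ⟩
    f v                         ∎
    where
    open ≡-Reasoning
    subst-δ : ∀ w (v≟w : Dec (v ≡ w)) → f w * + 𝕀 (does v≟w) ≡ f v * + 𝕀 (does v≟w)
    subst-δ w (yes refl) = refl
    subst-δ w (no _)     = trans (ℤₚ.*-zeroʳ (f w)) (sym (ℤₚ.*-zeroʳ (f v)))

  χ : List ℕ → Elem → ℤ
  χ q x = ∑ℤ C (λ r → x r * + mark q r)

  χ-· : ∀ q x y → Positive q → χ q (x · y) ≡ χ q x * χ q y
  χ-· q x y pos = begin
    ∑ℤ C (λ w → (x · y) w * + mark q w)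
      ≡⟨ ∑ℤ-cong C (λ w → trans (cong (_* + mark q w) (·-expand x y w))
                          (trans (sym (∑ℤ-distribʳ-* C (+ mark q w) _))
                            (∑ℤ-cong C (λ s → trans (sym (∑ℤ-distribʳ-* C (+ mark q w) _))
                               (∑ℤ-cong C (λ t → regroup (x s) (y t) (+ count s t w) (+ mark q w))))))) ⟩
    ∑ℤ C (λ w → ∑ℤ C (λ s → ∑ℤ C (λ t → (x s * y t) * (+ count s t w * + mark q w))))
      ≡⟨ trans (∑ℤ-comm C C _) (∑ℤ-cong C (λ s → ∑ℤ-comm C C _)) ⟩
    ∑ℤ C (λ s → ∑ℤ C (λ t → ∑ℤ C (λ w → (x s * y t) * (+ count s t w * + mark q w))))
      ≡⟨ ∑ℤ-cong-All (compsF-compositions n n) (λ s (pos-s , s-sum) → ∑ℤ-cong C (λ t →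
           trans (∑ℤ-distribˡ-* C (x s * y t) _) (cong (x s * y t *_) (count-mark s t pos-s s-sum)))) ⟩
    ∑ℤ C (λ s → ∑ℤ C (λ t → (x s * y t) * (+ mark q s * + mark q t)))
      ≡⟨ ∑ℤ-cong C (λ s → trans (∑ℤ-cong C (λ t → interchange (x s) (y t) (+ mark q s) (+ mark q t)))
                                (∑ℤ-distribˡ-* C (x s * + mark q s) _)) ⟩
    ∑ℤ C (λ s → (x s * + mark q s) * χ q y)
      ≡⟨ ∑ℤ-distribʳ-* C (χ q y) _ ⟩
    χ q x * χ q y ∎
    where
    open ≡-Reasoning
    regroup : ∀ a b c d → a * b * c * d ≡ (a * b) * (c * d)
    regroup = solve-∀
    interchange : ∀ a b c d → (a * b) * (c * d) ≡ (a * c) * (b * d)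
    interchange = solve-∀
    count-mark : ∀ s t → Positive s → sum s ≡ n → ∑ℤ C (λ w → + count s t w * + mark q w) ≡ + mark q s * + mark q t
    count-mark s t pos-s s-sum = begin
      ∑ℤ C (λ w → + count s t w * + mark q w)  ≡⟨ ∑ℤ-cong C (λ w → sym (ℤₚ.pos-* (count s t w) (mark q w))) ⟩
      ∑ℤ C (λ w → + (count s t w ℕ.* mark q w)) ≡⟨ sym (pos-∑ C (λ w → count s t w ℕ.* mark q w)) ⟩
      + ∑ C (λ w → count s t w ℕ.* mark q w)    ≡⟨ cong +_ (∑-count-mark n q s t pos s-sum pos-s) ⟩
      + (mark q s ℕ.* mark q t)                 ≡⟨ ℤₚ.pos-* (mark q s) (mark q t) ⟩
      + mark q s * + mark q t                   ∎

  χ-− : ∀ q u v → χ q (u − v) ≡ χ q u - χ q v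
  χ-− q u v = trans (∑ℤ-cong C (λ r → distrib (u r) (v r) (+ mark q r))) (∑ℤ-distrib-- C _ _)
    where
    distrib : ∀ a b m → (a - b) * m ≡ a * m - b * m
    distrib = solve-∀

  χ-commutator : ∀ q a x y → Positive q → χ q (a · (x · y − y · x)) ≡ + 0
  χ-commutator q a x y pos = begin
    χ q (a · (x · y − y · x))                        ≡⟨ χ-· q a (x · y − y · x) pos ⟩
    χ q a * χ q (x · y − y · x)                      ≡⟨ cong (χ q a *_) (χ-− q (x · y) (y · x)) ⟩
    χ q a * (χ q (x · y) - χ q (y · x))              ≡⟨ cong (χ q a *_) (cong₂ _-_ (χ-· q x y pos) (χ-· q y x pos)) ⟩
    χ q a * (χ q x * χ q y - χ q y * χ q x)          ≡⟨ vanish (χ q a) (χ q x) (χ q y) ⟩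
    + 0                                              ∎
    where
    open ≡-Reasoning
    vanish : ∀ a b c → a * (b * c - c * b) ≡ + 0
    vanish = solve-∀

  VanishesBelow : ℕ → Elem → Set
  VanishesBelow k u = ∀ w → Positive w → length w < k → u w ≡ + 0

  vanishesBelow-· : ∀ k u d → (∀ q → Positive q → χ q d ≡ + 0) → VanishesBelow k u → VanishesBelow (suc k) (u · d)
  vanishesBelow-· k u d χd≡0 u≡0 w _ w<1+k =
    trans (·-expand u d w) (trans (∑ℤ-cong-All (compsF-compositions n n) (λ q (pos , _) → term q pos (length q <? k))) (∑ℤ-zero C))
    where
    term : ∀ q → Positive q → Dec (length q < k) → ∑ℤ C (λ r → u q * d r * + count q r w) ≡ + 0
    term q pos (yes q<k) = trans (∑ℤ-cong C (λ r → cong (λ z → z * d r * + count q r w) (u≡0 q pos q<k))) (∑ℤ-zero C)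
    term q pos (no  q≮k) = begin
      ∑ℤ C (λ r → u q * d r * + count q r w)
        ≡⟨ ∑ℤ-cong C (λ r → cong (u q * d r *_) (cong +_ (count-triangular q r w pos w≤q))) ⟩
      ∑ℤ C (λ r → u q * d r * + (δ q w ℕ.* mark q r))
        ≡⟨ ∑ℤ-cong C (λ r → trans (cong (u q * d r *_) (ℤₚ.pos-* (δ q w) (mark q r))) (regroup (u q) (d r) (+ δ q w) (+ mark q r))) ⟩
      ∑ℤ C (λ r → u q * + δ q w * (d r * + mark q r))
        ≡⟨ ∑ℤ-distribˡ-* C (u q * + δ q w) (λ r → d r * + mark q r) ⟩
      u q * + δ q w * χ q d
        ≡⟨ cong (u q * + δ q w *_) (χd≡0 q pos) ⟩
      u q * + δ q w * + 0
        ≡⟨ ℤₚ.*-zeroʳ (u q * + δ q w) ⟩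
      + 0 ∎
      where
      open ≡-Reasoning
      w≤q : length w ≤ length q
      w≤q = ℕₚ.≤-trans (ℕₚ.≤-pred w<1+k) (ℕₚ.≮⇒≥ q≮k)
      regroup : ∀ a b c m → a * b * (c * m) ≡ a * c * (b * m)
      regroup = solve-∀

  infixr 8 _^_
  _^_ : Elem → ℕ → Elem
  d ^ zero  = 𝟙 n
  d ^ suc k = d ^ k · d

  vanishesBelow-^ : ∀ d → (∀ q → Positive q → χ q d ≡ + 0) → ∀ k → VanishesBelow k (d ^ k)
  vanishesBelow-^ d χd≡0 zero    w _ ()
  vanishesBelow-^ d χd≡0 (suc k) = vanishesBelow-· k (d ^ k) d χd≡0 (vanishesBelow-^ d χd≡0 k)

  ·-identityʳ : ∀ x w → 1 ≤ n → IsComposition n w → (x · 𝟙 n) w ≡ x w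
  ·-identityʳ x w 1≤n w∈ = begin
    (x · 𝟙 n) w
      ≡⟨ ·-expand x (𝟙 n) w ⟩
    ∑ℤ C (λ q → ∑ℤ C (λ r → x q * 𝟙 n r * + count q r w))
      ≡⟨ ∑ℤ-cong C (λ q → trans (∑ℤ-cong C (λ r → unit-term q r)) (∑ℤ-distribˡ-* C (x q) _)) ⟩
    ∑ℤ C (λ q → x q * ∑ℤ C (λ r → + (δ (n ∷ []) r ℕ.* count q r w)))
      ≡⟨ ∑ℤ-cong-All (compsF-compositions n n) (λ q (pos , q-sum) → cong (x q *_) (begin
           ∑ℤ C (λ r → + (δ (n ∷ []) r ℕ.* count q r w))  ≡⟨ sym (pos-∑ C (λ r → δ (n ∷ []) r ℕ.* count q r w)) ⟩
           + ∑ C (λ r → δ (n ∷ []) r ℕ.* count q r w)     ≡⟨ cong +_ (∑-comps-sift n (n ∷ []) (λ r → count q r w) (1≤n All.∷ All.[] , ℕₚ.+-identityʳ n)) ⟩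
           + count q (n ∷ []) w                             ≡⟨ cong (λ m → + count q (m ∷ []) w) (sym q-sum) ⟩
           + count q (sum q ∷ []) w                         ≡⟨ cong +_ (count-column q w pos) ⟩
           + δ q w                                          ∎)) ⟩
    ∑ℤ C (λ q → x q * + δ q w)
      ≡⟨ ∑ℤ-cong C (λ q → cong (λ k → x q * + k) (δ-sym q w)) ⟩
    ∑ℤ C (λ q → x q * + δ w q)
      ≡⟨ ∑ℤ-comps-sift w x w∈ ⟩
    x w ∎
    where
    open ≡-Reasoning
    unit-term : ∀ q r → x q * 𝟙 n r * + count q r w ≡ x q * + (δ (n ∷ []) r ℕ.* count q r w)
    unit-term q r = begin
      x q * 𝟙 n r * + count q r w                   ≡⟨ ℤₚ.*-assoc (x q) (𝟙 n r) (+ count q r w) ⟩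
      x q * (𝟙 n r * + count q r w)                 ≡⟨ cong (λ e → x q * (e * + count q r w)) (trans (𝟙-δ r) (cong +_ (δ-sym r (n ∷ [])))) ⟩
      x q * (+ δ (n ∷ []) r * + count q r w)        ≡⟨ cong (x q *_) (sym (ℤₚ.pos-* (δ (n ∷ []) r) (count q r w))) ⟩
      x q * + (δ (n ∷ []) r ℕ.* count q r w)        ∎

  ·-zeroˡ : ∀ y w → ((λ _ → + 0) · y) w ≡ + 0
  ·-zeroˡ y w = trans (·-expand (λ _ → + 0) y w) (trans (∑ℤ-cong C (λ q → ∑ℤ-zero C)) (∑ℤ-zero C))

  ·-distribʳ-+ : ∀ f g y w → ((λ v → f v + g v) · y) w ≡ (f · y) w + (g · y) w
  ·-distribʳ-+ f g y w = begin
    ((λ v → f v + g v) · y) w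
      ≡⟨ ·-expand (λ v → f v + g v) y w ⟩
    ∑ℤ C (λ q → ∑ℤ C (λ r → (f q + g q) * y r * + count q r w))
      ≡⟨ ∑ℤ-cong C (λ q → trans (∑ℤ-cong C (λ r → distrib (f q) (g q) (y r) (+ count q r w))) (∑ℤ-distrib-+ C _ _)) ⟩
    ∑ℤ C (λ q → ∑ℤ C (λ r → f q * y r * + count q r w) + ∑ℤ C (λ r → g q * y r * + count q r w))
      ≡⟨ ∑ℤ-distrib-+ C _ _ ⟩
    ∑ℤ C (λ q → ∑ℤ C (λ r → f q * y r * + count q r w)) + ∑ℤ C (λ q → ∑ℤ C (λ r → g q * y r * + count q r w))
      ≡⟨ sym (cong₂ _+_ (·-expand f y w) (·-expand g y w)) ⟩
    (f · y) w + (g · y) w ∎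
    where
    open ≡-Reasoning
    distrib : ∀ a b c m → (a + b) * c * m ≡ a * c * m + b * c * m
    distrib = solve-∀

  ·-distribˡ-− : ∀ x y z w → (x · (y − z)) w ≡ (x · y) w - (x · z) w
  ·-distribˡ-− x y z w = begin
    (x · (y − z)) w
      ≡⟨ ·-expand x (y − z) w ⟩
    ∑ℤ C (λ q → ∑ℤ C (λ r → x q * (y r - z r) * + count q r w))
      ≡⟨ ∑ℤ-cong C (λ q → trans (∑ℤ-cong C (λ r → distrib (x q) (y r) (z r) (+ count q r w))) (∑ℤ-distrib-- C _ _)) ⟩
    ∑ℤ C (λ q → ∑ℤ C (λ r → x q * y r * + count q r w) - ∑ℤ C (λ r → x q * z r * + count q r w))
      ≡⟨ ∑ℤ-distrib-- C _ _ ⟩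
    ∑ℤ C (λ q → ∑ℤ C (λ r → x q * y r * + count q r w)) - ∑ℤ C (λ q → ∑ℤ C (λ r → x q * z r * + count q r w))
      ≡⟨ sym (cong₂ _-_ (·-expand x y w) (·-expand x z w)) ⟩
    (x · y) w - (x · z) w ∎
    where
    open ≡-Reasoning
    distrib : ∀ a b c m → a * (b - c) * m ≡ a * b * m - a * c * m
    distrib = solve-∀

  geometric : Elem → ℕ → Elem
  geometric d zero    _ = + 0
  geometric d (suc k) w = geometric d k w + (d ^ k) w

  geometric-telescopes : ∀ d k w → 1 ≤ n → IsComposition n w → (geometric d k · (𝟙 n − d)) w ≡ 𝟙 n w - (d ^ k) w
  geometric-telescopes d zero    w _   _  = trans (·-zeroˡ (𝟙 n − d) w) (sym (ℤₚ.+-inverseʳ (𝟙 n w)))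
  geometric-telescopes d (suc k) w 1≤n w∈ = begin
    (geometric d (suc k) · (𝟙 n − d)) w
      ≡⟨ ·-distribʳ-+ (geometric d k) (d ^ k) (𝟙 n − d) w ⟩
    (geometric d k · (𝟙 n − d)) w + (d ^ k · (𝟙 n − d)) w
      ≡⟨ cong₂ _+_ (geometric-telescopes d k w 1≤n w∈) (·-distribˡ-− (d ^ k) (𝟙 n) d w) ⟩
    (𝟙 n w - (d ^ k) w) + ((d ^ k · 𝟙 n) w - (d ^ k · d) w)
      ≡⟨ cong (λ e → (𝟙 n w - (d ^ k) w) + (e - (d ^ k · d) w)) (·-identityʳ (d ^ k) w 1≤n w∈) ⟩
    (𝟙 n w - (d ^ k) w) + ((d ^ k) w - (d ^ suc k) w)
      ≡⟨ cancel (𝟙 n w) ((d ^ k) w) ((d ^ suc k) w) ⟩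
    𝟙 n w - (d ^ suc k) w ∎
    where
    open ≡-Reasoning
    cancel : ∀ a b c → (a - b) + (b - c) ≡ a - c
    cancel = solve-∀

  geometric-inverse : ∀ d k w → 1 ≤ n → IsComposition n w → (d ^ k) w ≡ + 0 → (geometric d k · (𝟙 n − d)) w ≡ 𝟙 n w
  geometric-inverse d k w 1≤n w∈ dᵏ≡0 = begin
    (geometric d k · (𝟙 n − d)) w  ≡⟨ geometric-telescopes d k w 1≤n w∈ ⟩
    𝟙 n w - (d ^ k) w              ≡⟨ cong (_-_ (𝟙 n w)) dᵏ≡0 ⟩
    𝟙 n w - + 0                    ≡⟨ ℤₚ.+-identityʳ (𝟙 n w) ⟩
    𝟙 n w                          ∎
    where open ≡-Reasoning

  commutator-nilpotent : ∀ a x y w → IsComposition n w → ((a · (x · y − y · x)) ^ suc n) w ≡ + 0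
  commutator-nilpotent a x y w (pos , w-sum) =
    vanishesBelow-^ (a · (x · y − y · x)) (λ q pos-q → χ-commutator q a x y pos-q) (suc n) w pos
                    (s≤s (subst (length w ≤_) w-sum (length≤sum w pos)))

open Marks using (IsComposition)
open import Data.Integer using (+_; _-_)
open import Data.Integer.Properties using (+-inverseʳ)
open import Data.Integer.Divisibility using () renaming (_∣_ to _∣ℤ_)
open import Data.Nat using (_≥_)
open import Data.Nat.Divisibility using (_∣0)
open import Data.Nat.Primality using (Prime)
open import Data.Product using (_,_)
open import Relation.Binary.PropositionalEquality

mainTheorem3 : (n p : ℕ) → n ≥ 1 → Prime p →
    (x y : Elem) → InRadical n p (_⊖_ n (_⋆_ n x y) (_⋆_ n y x))
mainTheorem3 n p n≥1 _ x y a = geometric d (suc n) , λ w w∈ →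
  subst (+ p ∣ℤ_) (sym (defect-vanishes w (comps-compositions w∈))) (p ∣0)
  where
  open Descent n
  d : Elem
  d = a · (x · y − y · x)
  defect-vanishes : ∀ w → IsComposition n w → (geometric d (suc n) · (𝟙 n − d)) w - 𝟙 n w ≡ + 0
  defect-vanishes w w∈ =
    trans (cong (_- 𝟙 n w) (geometric-inverse d (suc n) w n≥1 w∈ (commutator-nilpotent a x y w w∈)))
          (+-inverseʳ (𝟙 n w))
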